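{- As $m \to + \infty$, $$\mathsf{D}^{(3)} (\mathcal{B}^{(2)}_m) \sim \frac{3 \sqrt{3}}{2} m^2,$$ i.e. the ratio of the two sides tends to $1$.
   Context: A sequence over a subset $X$ of an abelian group is a finite unordered sequence (multiset) of elements of $X$; its length is the number of terms (with multiplicity) and its support is the set of distinct elements occurring in it. It is a minimal zero-sum sequence if its terms sum to $0$ and no non-empty proper subsequence sums to $0$. For a positive integer $k$, $\mathsf{D}^{(k)}(X)$ denotes the largest length of a minimal zero-sum sequence over $X$ whose support has exactly $k$ elements. For positive integers $d,m$, $\mathcal{B}^{(d)}_m=\{(u_1,\dots,u_d)\in\mathbb{Z}^d : u_1^2+\cdots+u_d^2\le m^2\}\subseteq \mathbb{Z}^d$. -}

module Defs where

open import Data.Nat as ℕ using (ℕ)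
open import Data.Integer as ℤ using (ℤ; +_)
open import Data.Product using (_×_; _,_; Σ; ∃)
open import Data.Product.Properties using (≡-dec)
open import Data.List using (List; []; _∷_; length; foldr; deduplicate)
open import Data.List.Relation.Unary.All using (All)
open import Data.List.Relation.Binary.Sublist.Propositional using (_⊆_)
open import Relation.Binary.PropositionalEquality using (_≡_; _≢_)
open import Relation.Nullary using (¬_)

Point : Set
Point = ℤ × ℤ

_≟P_ : (p q : Point) → Relation.Nullary.Dec (p ≡ q)
_≟P_ = ≡-dec ℤ._≟_ ℤ._≟_

_+P_ : Point → Point → Point
(a , b) +P (c , d) = (a ℤ.+ c) , (b ℤ.+ d)

0P : Point
0P = (+ 0) , (+ 0)

InBall : ℕ → Point → Set
InBall m (u₁ , u₂) = u₁ ℤ.* u₁ ℤ.+ u₂ ℤ.* u₂ ℤ.≤ (+ m) ℤ.* (+ m)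

-- A sequence (multiset) is represented by a list; order is irrelevant for
-- all notions below (subsequences of a multiset = sublists of a list).
Seq : Set
Seq = List Point

σ : Seq → Point
σ = foldr _+P_ 0P

ZeroSum : Seq → Set
ZeroSum S = σ S ≡ 0P

MinimalZeroSum : Seq → Set
MinimalZeroSum S =
  ZeroSum S × (S ≢ []) ×
  (∀ (T : Seq) → T ⊆ S → T ≢ [] → length T ℕ.< length S → ¬ ZeroSum T)

supportSize : Seq → ℕ
supportSize S = length (deduplicate _≟P_ S)

-- L is the length of some minimal zero-sum sequence over B^{(2)}_m with
-- support of exactly 3 elements.  D^{(3)}(B^{(2)}_m) is the largest such L.
Achievable3 : ℕ → ℕ → Set
Achievable3 m L =
  Σ Seq λ S → All (InBall m) S × MinimalZeroSum S × supportSize S ≡ 3 × length S ≡ L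

-- Let the support be {a, b, c} with multiplicities x, y, z: then (x, y, z) is a minimal nonzero
-- solution of x a + y b + z c = 0.  If b × c ≠ 0, Cramer's rule makes it proportional to
-- (|b × c|, |c × a|, |a × b|), which is again a solution, so minimality bounds the length by
-- |b × c| + |c × a| + |a × b| = 2 area(abc), and Heron's formula bounds twice the area of a
-- triangle in the disc of radius m by (3√3/2) m².  Collinear points give a one-dimensional problem
-- in which the length is at most 4m.
-- Conversely, for m ∈ {2h + 2, 2h + 3} and t + 1 = ⌊√(m² − h²)⌋, the points (t, h), (1, −2h − 1)
-- and (−t − 1, h) of the disc have (X + 1, 2ht + h, X), X = 2ht + t + h, as their only nonzero
-- relation below it; its length is about 6ht ≈ (3√3/2) m².

module Submission where

open import Defs
open import Data.Nat using (ℕ; _+_; _*_; _^_; _≤_; _≥_)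
open import Data.Product using (_×_; Σ; ∃)

open import Data.Nat as ℕ using (zero; suc; z≤n; s≤s; _<_; _≤?_; _∸_)
import Data.Nat.Properties as ℕₚ
open import Data.Nat.Tactic.RingSolver using () renaming (solve-∀ to solveℕ)
open import Data.Integer as ℤ using (ℤ; +_; -[1+_]; +[1+_]; ∣_∣; +≤+)
  renaming (_+_ to _+ᶻ_; _*_ to _*ᶻ_; -_ to -ᶻ_; _-_ to _-ᶻ_; _≤_ to _≤ᶻ_)
import Data.Integer.Properties as ℤₚ
open import Data.Integer.Tactic.RingSolver using () renaming (solve-∀ to solveℤ)
open import Data.Product using (_,_; proj₁; proj₂; map₁; map₂)
open import Data.Sum using (_⊎_; inj₁; inj₂)
open import Data.Empty using (⊥-elim)
open import Data.List using ([]; _∷_; length; deduplicate; filter; replicate; _++_)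
import Data.List.Properties as Listₚ
open import Data.List.Relation.Unary.All as All using (All; []; _∷_)
import Data.List.Relation.Unary.All.Properties as Allₚ
open import Data.List.Relation.Unary.Any using (here; there)
open import Data.List.Relation.Unary.AllPairs using ([]; _∷_)
import Data.List.Relation.Unary.Unique.DecPropositional.Properties as Uniqueₚ
open import Data.List.Relation.Binary.Sublist.Propositional using (_⊆_; []; _∷ʳ_; _∷_)
open import Data.List.Relation.Binary.Sublist.Propositional.Properties using (All-resp-⊆)
open import Data.List.Membership.Propositional using (_∈_)
open import Data.List.Membership.Propositional.Properties using (∈-deduplicate⁻; ∈-deduplicate⁺)
open import Function using (_∘_; _⇔_; mk⇔; Equivalence)
open import Relation.Nullary using (Dec; yes; no; ¬_)
open import Relation.Nullary.Decidable using (¬?)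
open import Relation.Binary.PropositionalEquality

-- Triangles in the plane

i*i≡∣i∣*∣i∣ : ∀ i → i *ᶻ i ≡ + (∣ i ∣ * ∣ i ∣)
i*i≡∣i∣*∣i∣ (+ n) = sym (ℤₚ.pos-* n n)
i*i≡∣i∣*∣i∣ -[1+ n ] = refl

0≤i*i : ∀ i → + 0 ≤ᶻ i *ᶻ i
0≤i*i i rewrite i*i≡∣i∣*∣i∣ i = +≤+ z≤n

i+j≡k⇒i≤k : ∀ {i j k} → i +ᶻ j ≡ k → + 0 ≤ᶻ j → i ≤ᶻ k
i+j≡k⇒i≤k {i} {j} refl 0≤j = subst (_≤ᶻ i +ᶻ j) (ℤₚ.+-identityʳ i) (ℤₚ.+-monoʳ-≤ i 0≤j)

_-P_ : Point → Point → Point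
(a₁ , a₂) -P (b₁ , b₂) = a₁ -ᶻ b₁ , a₂ -ᶻ b₂

norm² : Point → ℤ
norm² (u₁ , u₂) = u₁ *ᶻ u₁ +ᶻ u₂ *ᶻ u₂

0≤norm² : ∀ u → + 0 ≤ᶻ norm² u
0≤norm² (u₁ , u₂) = ℤₚ.+-mono-≤ (0≤i*i u₁) (0≤i*i u₂)

cross : Point → Point → ℤ
cross (a₁ , a₂) (b₁ , b₂) = a₁ *ᶻ b₂ -ᶻ a₂ *ᶻ b₁

doubleArea : Point → Point → Point → ℤ
doubleArea a b c = cross b c +ᶻ cross c a +ᶻ cross a b

sideSum : Point → Point → Point → ℤ
sideSum a b c = norm² (b -P c) +ᶻ norm² (c -P a) +ᶻ norm² (a -P b)

-- Heron's formula 16 area² = 2 (PQ + QR + RP) − P² − Q² − R², with P, Q, R the squared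
-- side lengths and Δ = 2 area.
heron-identity : ∀ a₁ a₂ b₁ b₂ c₁ c₂ →
  let P = (b₁ -ᶻ c₁) *ᶻ (b₁ -ᶻ c₁) +ᶻ (b₂ -ᶻ c₂) *ᶻ (b₂ -ᶻ c₂)
      Q = (c₁ -ᶻ a₁) *ᶻ (c₁ -ᶻ a₁) +ᶻ (c₂ -ᶻ a₂) *ᶻ (c₂ -ᶻ a₂)
      R = (a₁ -ᶻ b₁) *ᶻ (a₁ -ᶻ b₁) +ᶻ (a₂ -ᶻ b₂) *ᶻ (a₂ -ᶻ b₂)
      Δ = (b₁ *ᶻ c₂ -ᶻ b₂ *ᶻ c₁) +ᶻ (c₁ *ᶻ a₂ -ᶻ c₂ *ᶻ a₁) +ᶻ (a₁ *ᶻ b₂ -ᶻ a₂ *ᶻ b₁)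
  in + 12 *ᶻ (Δ *ᶻ Δ) +ᶻ + 2 *ᶻ ((P -ᶻ Q) *ᶻ (P -ᶻ Q) +ᶻ (Q -ᶻ R) *ᶻ (Q -ᶻ R) +ᶻ (R -ᶻ P) *ᶻ (R -ᶻ P))
     ≡ (P +ᶻ Q +ᶻ R) *ᶻ (P +ᶻ Q +ᶻ R)
heron-identity = solveℤ

sideSum-identity : ∀ a₁ a₂ b₁ b₂ c₁ c₂ →
  ((b₁ -ᶻ c₁) *ᶻ (b₁ -ᶻ c₁) +ᶻ (b₂ -ᶻ c₂) *ᶻ (b₂ -ᶻ c₂)) +ᶻ ((c₁ -ᶻ a₁) *ᶻ (c₁ -ᶻ a₁) +ᶻ (c₂ -ᶻ a₂) *ᶻ (c₂ -ᶻ a₂))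
    +ᶻ ((a₁ -ᶻ b₁) *ᶻ (a₁ -ᶻ b₁) +ᶻ (a₂ -ᶻ b₂) *ᶻ (a₂ -ᶻ b₂))
    +ᶻ ((a₁ +ᶻ b₁ +ᶻ c₁) *ᶻ (a₁ +ᶻ b₁ +ᶻ c₁) +ᶻ (a₂ +ᶻ b₂ +ᶻ c₂) *ᶻ (a₂ +ᶻ b₂ +ᶻ c₂))
  ≡ + 3 *ᶻ ((a₁ *ᶻ a₁ +ᶻ a₂ *ᶻ a₂) +ᶻ (b₁ *ᶻ b₁ +ᶻ b₂ *ᶻ b₂) +ᶻ (c₁ *ᶻ c₁ +ᶻ c₂ *ᶻ c₂))
sideSum-identity = solveℤ

12*doubleArea²≤sideSum² : ∀ a b c →
  + 12 *ᶻ (doubleArea a b c *ᶻ doubleArea a b c) ≤ᶻ sideSum a b c *ᶻ sideSum a b c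
12*doubleArea²≤sideSum² a@(a₁ , a₂) b@(b₁ , b₂) c@(c₁ , c₂) =
  i+j≡k⇒i≤k (heron-identity a₁ a₂ b₁ b₂ c₁ c₂) (ℤₚ.*-monoˡ-≤-nonNeg (+ 2) {+ 0}
    (ℤₚ.+-mono-≤ (ℤₚ.+-mono-≤ (0≤i*i (P -ᶻ Q)) (0≤i*i (Q -ᶻ R))) (0≤i*i (R -ᶻ P))))
  where
  P = norm² (b -P c)
  Q = norm² (c -P a)
  R = norm² (a -P b)

sideSum≤3*Σnorm² : ∀ a b c → sideSum a b c ≤ᶻ + 3 *ᶻ (norm² a +ᶻ norm² b +ᶻ norm² c)
sideSum≤3*Σnorm² (a₁ , a₂) (b₁ , b₂) (c₁ , c₂) =
  i+j≡k⇒i≤k (sideSum-identity a₁ a₂ b₁ b₂ c₁ c₂) (0≤norm² (a₁ +ᶻ b₁ +ᶻ c₁ , a₂ +ᶻ b₂ +ᶻ c₂))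

0≤sideSum : ∀ a b c → + 0 ≤ᶻ sideSum a b c
0≤sideSum a b c = ℤₚ.+-mono-≤ (ℤₚ.+-mono-≤ (0≤norm² (b -P c)) (0≤norm² (c -P a))) (0≤norm² (a -P b))

doubleArea-bound : ∀ {m} a b c → InBall m a → InBall m b → InBall m c →
  4 * (∣ doubleArea a b c ∣ * ∣ doubleArea a b c ∣) ≤ 27 * (m * m * (m * m))
doubleArea-bound {m} a b c a∈B b∈B c∈B = ℕₚ.*-cancelˡ-≤ 3 (begin
  3 * (4 * (D * D))             ≡⟨ twelve D ⟩
  12 * (D * D)                  ≤⟨ 12D²≤S² ⟩
  ∣ S ∣ * ∣ S ∣                 ≤⟨ ℕₚ.*-mono-≤ S≤9m² S≤9m² ⟩
  9 * (m * m) * (9 * (m * m))   ≡⟨ eightyOne (m * m) ⟩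
  3 * (27 * (m * m * (m * m)))  ∎)
  where
  open ℕₚ.≤-Reasoning
  Δ = doubleArea a b c
  D = ∣ Δ ∣
  S = sideSum a b c
  12D²≤S² : 12 * (D * D) ≤ ∣ S ∣ * ∣ S ∣
  12D²≤S² = ℤₚ.drop‿+≤+ (subst₂ _≤ᶻ_
    (trans (cong (+ 12 *ᶻ_) (i*i≡∣i∣*∣i∣ Δ)) (sym (ℤₚ.pos-* 12 (D * D)))) (i*i≡∣i∣*∣i∣ S)
    (12*doubleArea²≤sideSum² a b c))
  S≤9m² : ∣ S ∣ ≤ 9 * (m * m)
  S≤9m² = ℤₚ.drop‿+≤+ (subst₂ _≤ᶻ_ (sym (ℤₚ.0≤i⇒+∣i∣≡i (0≤sideSum a b c))) nine
    (ℤₚ.≤-trans (sideSum≤3*Σnorm² a b c) (ℤₚ.*-monoˡ-≤-nonNeg (+ 3) (ℤₚ.+-mono-≤ (ℤₚ.+-mono-≤ a∈B b∈B) c∈B))))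
    where
    nine : + 3 *ᶻ (+ m *ᶻ + m +ᶻ + m *ᶻ + m +ᶻ + m *ᶻ + m) ≡ + (9 * (m * m))
    nine = trans (thrice (+ m)) (trans (cong (+ 9 *ᶻ_) (sym (ℤₚ.pos-* m m))) (sym (ℤₚ.pos-* 9 (m * m))))
      where thrice : ∀ X → + 3 *ᶻ (X *ᶻ X +ᶻ X *ᶻ X +ᶻ X *ᶻ X) ≡ + 9 *ᶻ (X *ᶻ X)
            thrice = solveℤ
  twelve : ∀ D → 3 * (4 * (D * D)) ≡ 12 * (D * D)
  twelve = solveℕ
  eightyOne : ∀ M → 9 * M * (9 * M) ≡ 3 * (27 * (M * M))
  eightyOne = solveℕ

-- Relations among three points

infix 25 _·_
_·_ : ℕ → Point → Point
n · (u₁ , u₂) = + n *ᶻ u₁ , + n *ᶻ u₂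

infix 25 -P_
-P_ : Point → Point
-P (u₁ , u₂) = -ᶻ u₁ , -ᶻ u₂

comb : ℕ → ℕ → ℕ → Point → Point → Point → Point
comb x y z a b c = x · a +P (y · b +P z · c)

record IsMinimalRelation (a b c : Point) (x y z : ℕ) : Set where
  constructor minimalRelation
  field
    relation : comb x y z a b c ≡ 0P
    minimal  : ∀ p q r → p ≤ x → q ≤ y → r ≤ z → 1 ≤ p + q + r →
               comb p q r a b c ≡ 0P → x + y + z ≤ p + q + r
open IsMinimalRelation public

comb-swap₁₂ : ∀ p q r a b c → comb q p r b a c ≡ comb p q r a b c
comb-swap₁₂ p q r (a₁ , a₂) (b₁ , b₂) (c₁ , c₂) =
  cong₂ _,_ (swap (+ p *ᶻ a₁) (+ q *ᶻ b₁) (+ r *ᶻ c₁)) (swap (+ p *ᶻ a₂) (+ q *ᶻ b₂) (+ r *ᶻ c₂))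
  where swap : ∀ i j k → j +ᶻ (i +ᶻ k) ≡ i +ᶻ (j +ᶻ k)
        swap = solveℤ

comb-swap₂₃ : ∀ p q r a b c → comb p r q a c b ≡ comb p q r a b c
comb-swap₂₃ p q r (a₁ , a₂) (b₁ , b₂) (c₁ , c₂) =
  cong₂ _,_ (swap (+ p *ᶻ a₁) (+ q *ᶻ b₁) (+ r *ᶻ c₁)) (swap (+ p *ᶻ a₂) (+ q *ᶻ b₂) (+ r *ᶻ c₂))
  where swap : ∀ i j k → i +ᶻ (k +ᶻ j) ≡ i +ᶻ (j +ᶻ k)
        swap = solveℤ

comb-neg : ∀ p q r a b c → comb p q r (-P a) (-P b) (-P c) ≡ -P comb p q r a b c
comb-neg p q r (a₁ , a₂) (b₁ , b₂) (c₁ , c₂) = cong₂ _,_ (neg (+ p) (+ q) (+ r) a₁ b₁ c₁) (neg (+ p) (+ q) (+ r) a₂ b₂ c₂)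
  where neg : ∀ P Q R a b c → P *ᶻ -ᶻ a +ᶻ (Q *ᶻ -ᶻ b +ᶻ R *ᶻ -ᶻ c) ≡ -ᶻ (P *ᶻ a +ᶻ (Q *ᶻ b +ᶻ R *ᶻ c))
        neg = solveℤ

-P-involutive : ∀ u → -P (-P u) ≡ u
-P-involutive (u₁ , u₂) = cong₂ _,_ (ℤₚ.neg-involutive u₁) (ℤₚ.neg-involutive u₂)

swap₁₂ : ∀ {a b c x y z} → IsMinimalRelation a b c x y z → IsMinimalRelation b a c y x z
swap₁₂ {a} {b} {c} {x} {y} {z} (minimalRelation rel minimal) =
  minimalRelation (trans (comb-swap₁₂ x y z a b c) rel) λ q p r q≤y p≤x r≤z 1≤qpr rel′ →
    subst₂ _≤_ (swap x y z) (swap p q r)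
      (minimal p q r p≤x q≤y r≤z (subst (1 ≤_) (swap q p r) 1≤qpr) (trans (sym (comb-swap₁₂ p q r a b c)) rel′))
  where swap : ∀ i j k → i + j + k ≡ j + i + k
        swap = solveℕ

swap₂₃ : ∀ {a b c x y z} → IsMinimalRelation a b c x y z → IsMinimalRelation a c b x z y
swap₂₃ {a} {b} {c} {x} {y} {z} (minimalRelation rel minimal) =
  minimalRelation (trans (comb-swap₂₃ x y z a b c) rel) λ p r q p≤x r≤z q≤y 1≤prq rel′ →
    subst₂ _≤_ (swap x y z) (swap p q r)
      (minimal p q r p≤x q≤y r≤z (subst (1 ≤_) (swap p r q) 1≤prq) (trans (sym (comb-swap₂₃ p q r a b c)) rel′))
  where swap : ∀ i j k → i + j + k ≡ i + k + j
        swap = solveℕ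

negate : ∀ {a b c x y z} → IsMinimalRelation a b c x y z → IsMinimalRelation (-P a) (-P b) (-P c) x y z
negate {a} {b} {c} {x} {y} {z} (minimalRelation rel minimal) =
  minimalRelation (trans (comb-neg x y z a b c) (cong -P_ rel)) λ p q r p≤x q≤y r≤z 1≤pqr rel′ →
    minimal p q r p≤x q≤y r≤z 1≤pqr
      (trans (sym (-P-involutive (comb p q r a b c))) (cong -P_ (trans (sym (comb-neg p q r a b c)) rel′)))

cramer : ∀ {x y z} a b c → comb x y z a b c ≡ 0P →
  + y *ᶻ cross b c ≡ + x *ᶻ cross c a × + z *ᶻ cross b c ≡ + x *ᶻ cross a b
cramer {x} {y} {z} (a₁ , a₂) (b₁ , b₂) (c₁ , c₂) rel =
  trans (eliminate-a₁ (+ x) (+ y) (+ z) a₁ a₂ b₁ b₂ c₁ c₂) (vanish _ c₂ c₁ (cong proj₁ rel) (cong proj₂ rel)) ,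
  trans (eliminate-a₂ (+ x) (+ y) (+ z) a₁ a₂ b₁ b₂ c₁ c₂) (vanish _ b₁ b₂ (cong proj₂ rel) (cong proj₁ rel))
  where
  eliminate-a₁ : ∀ X Y Z a₁ a₂ b₁ b₂ c₁ c₂ → Y *ᶻ (b₁ *ᶻ c₂ -ᶻ b₂ *ᶻ c₁) ≡ X *ᶻ (c₁ *ᶻ a₂ -ᶻ c₂ *ᶻ a₁) +ᶻ
    ((X *ᶻ a₁ +ᶻ (Y *ᶻ b₁ +ᶻ Z *ᶻ c₁)) *ᶻ c₂ -ᶻ (X *ᶻ a₂ +ᶻ (Y *ᶻ b₂ +ᶻ Z *ᶻ c₂)) *ᶻ c₁)
  eliminate-a₁ = solveℤ
  eliminate-a₂ : ∀ X Y Z a₁ a₂ b₁ b₂ c₁ c₂ → Z *ᶻ (b₁ *ᶻ c₂ -ᶻ b₂ *ᶻ c₁) ≡ X *ᶻ (a₁ *ᶻ b₂ -ᶻ a₂ *ᶻ b₁) +ᶻ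
    ((X *ᶻ a₂ +ᶻ (Y *ᶻ b₂ +ᶻ Z *ᶻ c₂)) *ᶻ b₁ -ᶻ (X *ᶻ a₁ +ᶻ (Y *ᶻ b₁ +ᶻ Z *ᶻ c₁)) *ᶻ b₂)
  eliminate-a₂ = solveℤ
  vanish : ∀ k u v {e₁ e₂} → e₁ ≡ + 0 → e₂ ≡ + 0 → k +ᶻ (e₁ *ᶻ u -ᶻ e₂ *ᶻ v) ≡ k
  vanish k u v refl refl = lemma k u v
    where lemma : ∀ k u v → k +ᶻ (+ 0 *ᶻ u -ᶻ + 0 *ᶻ v) ≡ k
          lemma = solveℤ

·-0P : ∀ n → n · 0P ≡ 0P
·-0P n = cong₂ _,_ (ℤₚ.*-zeroʳ (+ n)) (ℤₚ.*-zeroʳ (+ n))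

·-cancel : ∀ {n} e → 1 ≤ n → n · e ≡ 0P → e ≡ 0P
·-cancel {suc n} (e₁ , e₂) _ ne≡0 = cong₂ _,_ (cancel (cong proj₁ ne≡0)) (cancel (cong proj₂ ne≡0))
  where
  cancel : ∀ {i} → + suc n *ᶻ i ≡ + 0 → i ≡ + 0
  cancel eq with ℤₚ.i*j≡0⇒i≡0∨j≡0 (+ suc n) eq
  ... | inj₂ i≡0 = i≡0

comb-proportional : ∀ {x y z u v w} a b c → y * u ≡ x * v → z * u ≡ x * w →
  x · comb u v w a b c ≡ u · comb x y z a b c
comb-proportional {x} {y} {z} {u} {v} {w} (a₁ , a₂) (b₁ , b₂) (c₁ , c₂) yu≡xv zu≡xw =
  cong₂ _,_ (scale a₁ b₁ c₁) (scale a₂ b₂ c₂)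
  where
  open ≡-Reasoning
  toℤ : ∀ i j k l → i * j ≡ k * l → + k *ᶻ + l ≡ + i *ᶻ + j
  toℤ i j k l eq = trans (sym (ℤₚ.pos-* k l)) (trans (cong +_ (sym eq)) (ℤₚ.pos-* i j))
  expand : ∀ X U V W a b c → X *ᶻ (U *ᶻ a +ᶻ (V *ᶻ b +ᶻ W *ᶻ c)) ≡ U *ᶻ (X *ᶻ a) +ᶻ ((X *ᶻ V) *ᶻ b +ᶻ (X *ᶻ W) *ᶻ c)
  expand = solveℤ
  collect : ∀ X U Y Z a b c → U *ᶻ (X *ᶻ a) +ᶻ ((Y *ᶻ U) *ᶻ b +ᶻ (Z *ᶻ U) *ᶻ c) ≡ U *ᶻ (X *ᶻ a +ᶻ (Y *ᶻ b +ᶻ Z *ᶻ c))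
  collect = solveℤ
  scale : ∀ a b c → + x *ᶻ (+ u *ᶻ a +ᶻ (+ v *ᶻ b +ᶻ + w *ᶻ c)) ≡ + u *ᶻ (+ x *ᶻ a +ᶻ (+ y *ᶻ b +ᶻ + z *ᶻ c))
  scale a b c = begin
    + x *ᶻ (+ u *ᶻ a +ᶻ (+ v *ᶻ b +ᶻ + w *ᶻ c))                        ≡⟨ expand (+ x) (+ u) (+ v) (+ w) a b c ⟩
    + u *ᶻ (+ x *ᶻ a) +ᶻ ((+ x *ᶻ + v) *ᶻ b +ᶻ (+ x *ᶻ + w) *ᶻ c)     ≡⟨ cong₂ (λ s t → + u *ᶻ (+ x *ᶻ a) +ᶻ (s *ᶻ b +ᶻ t *ᶻ c))
                                                                          (toℤ y u x v yu≡xv) (toℤ z u x w zu≡xw) ⟩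
    + u *ᶻ (+ x *ᶻ a) +ᶻ ((+ y *ᶻ + u) *ᶻ b +ᶻ (+ z *ᶻ + u) *ᶻ c)     ≡⟨ collect (+ x) (+ u) (+ y) (+ z) a b c ⟩
    + u *ᶻ (+ x *ᶻ a +ᶻ (+ y *ᶻ b +ᶻ + z *ᶻ c))                        ∎

sum-proportional : ∀ x y z u v w → y * u ≡ x * v → z * u ≡ x * w → (x + y + z) * u ≡ x * (u + v + w)
sum-proportional x y z u v w yu≡xv zu≡xw = begin
  (x + y + z) * u        ≡⟨ ℕₚ.*-distribʳ-+ u (x + y) z ⟩
  (x + y) * u + z * u    ≡⟨ cong₂ _+_ (ℕₚ.*-distribʳ-+ u x y) zu≡xw ⟩
  x * u + y * u + x * w  ≡⟨ cong (λ s → x * u + s + x * w) yu≡xv ⟩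
  x * u + x * v + x * w  ≡⟨ sym (trans (ℕₚ.*-distribˡ-+ x (u + v) w) (cong (_+ x * w) (ℕₚ.*-distribˡ-+ x u v))) ⟩
  x * (u + v + w)        ∎
  where open ≡-Reasoning

-- A relation proportional to a minimal one is either below it, hence not shorter, or above it in
-- every coordinate, hence longer.
proportional-bound : ∀ {a b c x y z} u v w → IsMinimalRelation a b c x y z → comb u v w a b c ≡ 0P → 1 ≤ u →
  y * u ≡ x * v → z * u ≡ x * w → x + y + z ≤ u + v + w
proportional-bound {x = x} {y} {z} u v w R rel 1≤u yu≡xv zu≡xw with u ≤? x
... | yes u≤x = minimal R u v w u≤x (below yu≡xv) (below zu≡xw)
                  (ℕₚ.≤-trans 1≤u (ℕₚ.≤-trans (ℕₚ.m≤m+n u v) (ℕₚ.m≤m+n (u + v) w))) rel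
  where
  below : ∀ {y v} → y * u ≡ x * v → v ≤ y
  below {y} {v} yu≡xv = ℕₚ.*-cancelˡ-≤ u {{ℕ.>-nonZero 1≤u}} (begin
    u * v  ≤⟨ ℕₚ.*-monoˡ-≤ v u≤x ⟩
    x * v  ≡⟨ sym yu≡xv ⟩
    y * u  ≡⟨ ℕₚ.*-comm y u ⟩
    u * y  ∎)
    where open ℕₚ.≤-Reasoning
... | no u≰x = ℕₚ.*-cancelʳ-≤ (x + y + z) (u + v + w) u {{ℕ.>-nonZero 1≤u}} (begin
  (x + y + z) * u  ≡⟨ sum-proportional x y z u v w yu≡xv zu≡xw ⟩
  x * (u + v + w)  ≤⟨ ℕₚ.*-monoˡ-≤ (u + v + w) (ℕₚ.<⇒≤ (ℕₚ.≰⇒> u≰x)) ⟩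
  u * (u + v + w)  ≡⟨ ℕₚ.*-comm u (u + v + w) ⟩
  (u + v + w) * u  ∎)
  where open ℕₚ.≤-Reasoning

-- By Cramer's rule (x, y, z) is proportional to (|b × c|, |c × a|, |a × b|), a relation of length |Δ|.
noncollinear-bound : ∀ {a b c x y z} → 1 ≤ x → IsMinimalRelation a b c x y z →
  1 ≤ ∣ cross b c ∣ → x + y + z ≤ ∣ doubleArea a b c ∣
noncollinear-bound {a} {b} {c} {x} {y} {z} 1≤x R 1≤u =
  subst (x + y + z ≤_) (sym ∣Δ∣≡u+v+w) (proportional-bound u v w R rel′ 1≤u yu≡xv zu≡xw)
  where
  open ≡-Reasoning
  d₁ = cross b c
  d₂ = cross c a
  d₃ = cross a b
  u = ∣ d₁ ∣
  v = ∣ d₂ ∣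
  w = ∣ d₃ ∣
  yd₁≡xd₂ = proj₁ (cramer {x} {y} {z} a b c (relation R))
  zd₁≡xd₃ = proj₂ (cramer {x} {y} {z} a b c (relation R))
  yu≡xv : y * u ≡ x * v
  yu≡xv = trans (sym (ℤₚ.abs-* (+ y) d₁)) (trans (cong ∣_∣ yd₁≡xd₂) (ℤₚ.abs-* (+ x) d₂))
  zu≡xw : z * u ≡ x * w
  zu≡xw = trans (sym (ℤₚ.abs-* (+ z) d₁)) (trans (cong ∣_∣ zd₁≡xd₃) (ℤₚ.abs-* (+ x) d₃))
  rel′ : comb u v w a b c ≡ 0P
  rel′ = ·-cancel (comb u v w a b c) 1≤x (trans (comb-proportional {x} {y} {z} {u} {v} {w} a b c yu≡xv zu≡xw) (trans (cong (u ·_) (relation R)) (·-0P u)))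
  xΔ : + x *ᶻ doubleArea a b c ≡ + (x + y + z) *ᶻ d₁
  xΔ = begin
    + x *ᶻ (d₁ +ᶻ d₂ +ᶻ d₃)                ≡⟨ distrib (+ x) d₁ d₂ d₃ ⟩
    + x *ᶻ d₁ +ᶻ + x *ᶻ d₂ +ᶻ + x *ᶻ d₃    ≡⟨ cong₂ (λ s t → + x *ᶻ d₁ +ᶻ s +ᶻ t) (sym yd₁≡xd₂) (sym zd₁≡xd₃) ⟩
    + x *ᶻ d₁ +ᶻ + y *ᶻ d₁ +ᶻ + z *ᶻ d₁    ≡⟨ collect (+ x) (+ y) (+ z) d₁ ⟩
    (+ x +ᶻ + y +ᶻ + z) *ᶻ d₁              ≡⟨ cong (_*ᶻ d₁) (sym (trans (ℤₚ.pos-+ (x + y) z) (cong (_+ᶻ + z) (ℤₚ.pos-+ x y)))) ⟩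
    + (x + y + z) *ᶻ d₁                    ∎
    where
    distrib : ∀ X d₁ d₂ d₃ → X *ᶻ (d₁ +ᶻ d₂ +ᶻ d₃) ≡ X *ᶻ d₁ +ᶻ X *ᶻ d₂ +ᶻ X *ᶻ d₃
    distrib = solveℤ
    collect : ∀ X Y Z d → X *ᶻ d +ᶻ Y *ᶻ d +ᶻ Z *ᶻ d ≡ (X +ᶻ Y +ᶻ Z) *ᶻ d
    collect = solveℤ
  ∣Δ∣≡u+v+w : ∣ doubleArea a b c ∣ ≡ u + v + w
  ∣Δ∣≡u+v+w = ℕₚ.*-cancelˡ-≡ _ _ x {{ℕ.>-nonZero 1≤x}} (begin
    x * ∣ doubleArea a b c ∣  ≡⟨ sym (ℤₚ.abs-* (+ x) (doubleArea a b c)) ⟩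
    ∣ + x *ᶻ doubleArea a b c ∣ ≡⟨ trans (cong ∣_∣ xΔ) (ℤₚ.abs-* (+ (x + y + z)) d₁) ⟩
    (x + y + z) * u            ≡⟨ sum-proportional x y z u v w yu≡xv zu≡xw ⟩
    x * (u + v + w)            ∎)

collinear : ∀ {x y z} a b c → 1 ≤ x → comb x y z a b c ≡ 0P → cross b c ≡ + 0 →
  cross c a ≡ + 0 × cross a b ≡ + 0
collinear {x} {y} {z} a b c (s≤s _) rel d₁≡0 =
  vanish y (trans (sym (proj₁ (cramer {x} {y} {z} a b c rel))) (cong (+ y *ᶻ_) d₁≡0)) ,
  vanish z (trans (sym (proj₂ (cramer {x} {y} {z} a b c rel))) (cong (+ z *ᶻ_) d₁≡0))
  where
  vanish : ∀ {d} n → + x *ᶻ d ≡ + n *ᶻ + 0 → d ≡ + 0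
  vanish n eq with ℤₚ.i*j≡0⇒i≡0∨j≡0 (+ x) (trans eq (ℤₚ.*-zeroʳ (+ n)))
  ... | inj₂ d≡0 = d≡0

-- Collinear points

cross-multiply-< : ∀ x A z C → x * A ≤ z * C → z < A → 1 ≤ C → x < C
cross-multiply-< x A z C xA≤zC z<A 1≤C = ℕₚ.*-cancelʳ-< A x C (begin-strict
  x * A  ≤⟨ xA≤zC ⟩
  z * C  <⟨ ℕₚ.*-monoˡ-< C {{ℕ.>-nonZero 1≤C}} z<A ⟩
  A * C  ≡⟨ ℕₚ.*-comm A C ⟩
  C * A  ∎)
  where open ℕₚ.≤-Reasoning

m+m+[m+m]≡4m : ∀ m → m + m + (m + m) ≡ 4 * m
m+m+[m+m]≡4m = solveℕ

+-bounded : ∀ {m i j} → i ≤ m → j ≤ m → i + j ≤ 4 * m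
+-bounded {m} i≤m j≤m =
  ℕₚ.≤-trans (ℕₚ.+-mono-≤ i≤m j≤m) (subst (m + m ≤_) (m+m+[m+m]≡4m m) (ℕₚ.m≤m+n (m + m) (m + m)))

-- x A + y B = z C with A, B, C ∈ [1, m]; the last two hypotheses are minimality
-- against the relations (C, 0, A) and (0, C, B).
three-term-bound : ∀ m x y z A B C → A ≤ m → B ≤ m → C ≤ m → 1 ≤ A → 1 ≤ B → 1 ≤ C →
  x * A + y * B ≡ z * C →
  (C ≤ x → A ≤ z → x + y + z ≤ C + A) →
  (C ≤ y → B ≤ z → x + y + z ≤ C + B) →
  x + y + z ≤ 4 * m
three-term-bound m x y z A B C A≤m B≤m C≤m 1≤A 1≤B 1≤C balance via-CA via-CB with C ≤? x | C ≤? y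
... | yes C≤x | _ = ℕₚ.≤-trans (via-CA C≤x A≤z) (+-bounded C≤m A≤m)
  where
  A≤z : A ≤ z
  A≤z = ℕₚ.≮⇒≥ λ z<A → ℕₚ.≤⇒≯ C≤x (cross-multiply-< x A z C
          (subst (x * A ≤_) balance (ℕₚ.m≤m+n (x * A) (y * B))) z<A 1≤C)
... | no _ | yes C≤y = ℕₚ.≤-trans (via-CB C≤y B≤z) (+-bounded C≤m B≤m)
  where
  B≤z : B ≤ z
  B≤z = ℕₚ.≮⇒≥ λ z<B → ℕₚ.≤⇒≯ C≤y (cross-multiply-< y B z C
          (subst (y * B ≤_) balance (ℕₚ.m≤n+m (y * B) (x * A))) z<B 1≤C)
... | no C≰x | no C≰y = ℕₚ.<⇒≤ (begin-strict
  x + y + z        <⟨ ℕₚ.+-mono-<-≤ (ℕₚ.+-mono-< x<C y<C) (ℕₚ.<⇒≤ z<A+B) ⟩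
  C + C + (A + B)  ≤⟨ ℕₚ.+-mono-≤ (ℕₚ.+-mono-≤ C≤m C≤m) (ℕₚ.+-mono-≤ A≤m B≤m) ⟩
  m + m + (m + m)  ≡⟨ m+m+[m+m]≡4m m ⟩
  4 * m            ∎)
  where
  open ℕₚ.≤-Reasoning
  x<C = ℕₚ.≰⇒> C≰x
  y<C = ℕₚ.≰⇒> C≰y
  z<A+B : z < A + B
  z<A+B = ℕₚ.*-cancelʳ-< C z (A + B) (begin-strict
    z * C          ≡⟨ sym balance ⟩
    x * A + y * B  <⟨ ℕₚ.+-mono-< (ℕₚ.*-monoˡ-< A {{ℕ.>-nonZero 1≤A}} x<C) (ℕₚ.*-monoˡ-< B {{ℕ.>-nonZero 1≤B}} y<C) ⟩
    C * A + C * B  ≡⟨ sym (ℕₚ.*-distribˡ-+ C A B) ⟩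
    C * (A + B)    ≡⟨ ℕₚ.*-comm C (A + B) ⟩
    (A + B) * C    ∎)

onAxis : ℤ → Point
onAxis α = α , + 0

comb-onAxis₂ : ∀ p q r α β γ → proj₂ (comb p q r (onAxis α) (onAxis β) (onAxis γ)) ≡ + 0
comb-onAxis₂ p q r _ _ _ = vanish (+ p) (+ q) (+ r)
  where vanish : ∀ P Q R → P *ᶻ + 0 +ᶻ (Q *ᶻ + 0 +ᶻ R *ᶻ + 0) ≡ + 0
        vanish = solveℤ

¬3≤1 : ∀ {x y z} → 1 ≤ x → 1 ≤ y → 1 ≤ z → ¬ x + y + z ≤ 1
¬3≤1 1≤x 1≤y 1≤z x+y+z≤1 with ℕₚ.≤-trans (ℕₚ.+-mono-≤ (ℕₚ.+-mono-≤ 1≤x 1≤y) 1≤z) x+y+z≤1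
... | s≤s ()

¬minimal-through-0P : ∀ {b c x y z} → 1 ≤ x → 1 ≤ y → 1 ≤ z → ¬ IsMinimalRelation 0P b c x y z
¬minimal-through-0P 1≤x 1≤y 1≤z R = ¬3≤1 1≤x 1≤y 1≤z (minimal R 1 0 0 1≤x z≤n z≤n (s≤s z≤n) refl)

¬minimal-positive : ∀ {x y z A B C} → 1 ≤ x →
  ¬ IsMinimalRelation (onAxis +[1+ A ]) (onAxis +[1+ B ]) (onAxis +[1+ C ]) x y z
¬minimal-positive {suc x} {y} {z} {A} {B} {C} _ R = ℕₚ.1+n≢0 (ℤₚ.+-injective (begin
  + (suc x * suc A + (y * suc B + z * suc C))                        ≡⟨ ℤₚ.pos-+ (suc x * suc A) _ ⟩
  + (suc x * suc A) +ᶻ + (y * suc B + z * suc C)                      ≡⟨ cong₂ _+ᶻ_ (ℤₚ.pos-* (suc x) (suc A))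
                                                                            (trans (ℤₚ.pos-+ (y * suc B) _)
                                                                               (cong₂ _+ᶻ_ (ℤₚ.pos-* y (suc B)) (ℤₚ.pos-* z (suc C)))) ⟩
  + suc x *ᶻ +[1+ A ] +ᶻ (+ y *ᶻ +[1+ B ] +ᶻ + z *ᶻ +[1+ C ])        ≡⟨ cong proj₁ (relation R) ⟩
  + 0                                                                 ∎))
  where open ≡-Reasoning

balance : ∀ x y z A B C → (+ x *ᶻ + A +ᶻ (+ y *ᶻ + B +ᶻ + z *ᶻ -ᶻ + C) ≡ + 0) ⇔ (x * A + y * B ≡ z * C)
balance x y z A B C = mk⇔
  (λ eq → ℤₚ.+-injective (ℤₚ.i-j≡0⇒i≡j _ _ (trans (sym difference) eq)))
  (λ eq → trans difference (ℤₚ.i≡j⇒i-j≡0 (cong +_ eq)))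
  where
  open ≡-Reasoning
  P = + x *ᶻ + A
  Q = + y *ᶻ + B
  R = + z *ᶻ + C
  regroup : ∀ P Q R → P +ᶻ (Q +ᶻ -ᶻ R) ≡ P +ᶻ Q -ᶻ R
  regroup = solveℤ
  difference : P +ᶻ (Q +ᶻ + z *ᶻ -ᶻ + C) ≡ + (x * A + y * B) -ᶻ + (z * C)
  difference = begin
    P +ᶻ (Q +ᶻ + z *ᶻ -ᶻ + C)   ≡⟨ cong (λ t → P +ᶻ (Q +ᶻ t)) (sym (ℤₚ.neg-distribʳ-* (+ z) (+ C))) ⟩
    P +ᶻ (Q +ᶻ -ᶻ R)            ≡⟨ regroup P Q R ⟩
    P +ᶻ Q -ᶻ R                 ≡⟨ cong₂ (λ s t → s -ᶻ t)
                                     (trans (cong₂ _+ᶻ_ (sym (ℤₚ.pos-* x A)) (sym (ℤₚ.pos-* y B))) (sym (ℤₚ.pos-+ (x * A) (y * B))))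
                                     (sym (ℤₚ.pos-* z C)) ⟩
    + (x * A + y * B) -ᶻ + (z * C) ∎

axis-bound : ∀ {m x y z A B C} → suc A ≤ m → suc B ≤ m → suc C ≤ m →
  IsMinimalRelation (onAxis +[1+ A ]) (onAxis +[1+ B ]) (onAxis -[1+ C ]) x y z → x + y + z ≤ 4 * m
axis-bound {m} {x} {y} {z} {A} {B} {C} A<m B<m C<m R =
  three-term-bound m x y z (suc A) (suc B) (suc C) A<m B<m C<m (s≤s z≤n) (s≤s z≤n) (s≤s z≤n)
    (Equivalence.to (balance x y z (suc A) (suc B) (suc C)) (cong proj₁ (relation R)))
    (λ C≤x A≤z → subst (x + y + z ≤_) (cong (_+ suc A) (ℕₚ.+-identityʳ (suc C)))
       (minimal R (suc C) 0 (suc A) C≤x z≤n A≤z (s≤s z≤n)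
          (cong₂ _,_ (cancel-CA (+ suc A) (+ suc C) (+ suc B)) (comb-onAxis₂ (suc C) 0 (suc A) +[1+ A ] +[1+ B ] -[1+ C ]))))
    (λ C≤y B≤z → minimal R 0 (suc C) (suc B) z≤n C≤y B≤z (s≤s z≤n)
       (cong₂ _,_ (cancel-CB (+ suc A) (+ suc B) (+ suc C)) (comb-onAxis₂ 0 (suc C) (suc B) +[1+ A ] +[1+ B ] -[1+ C ])))
  where
  cancel-CA : ∀ P Q R → Q *ᶻ P +ᶻ (+ 0 *ᶻ R +ᶻ P *ᶻ -ᶻ Q) ≡ + 0
  cancel-CA = solveℤ
  cancel-CB : ∀ P R Q → + 0 *ᶻ P +ᶻ (Q *ᶻ R +ᶻ R *ᶻ -ᶻ Q) ≡ + 0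
  cancel-CB = solveℤ

+-swap₂₃ : ∀ x y z → x + z + y ≡ x + y + z
+-swap₂₃ = solveℕ

+-rotate : ∀ x y z → y + z + x ≡ x + y + z
+-rotate = solveℕ

line-bound : ∀ {m x y z} α β γ → ∣ α ∣ ≤ m → ∣ β ∣ ≤ m → ∣ γ ∣ ≤ m → 1 ≤ x → 1 ≤ y → 1 ≤ z →
  IsMinimalRelation (onAxis α) (onAxis β) (onAxis γ) x y z → x + y + z ≤ 4 * m
line-bound (+ 0) β γ _ _ _ 1≤x 1≤y 1≤z R = ⊥-elim (¬minimal-through-0P 1≤x 1≤y 1≤z R)
line-bound α (+ 0) γ _ _ _ 1≤x 1≤y 1≤z R = ⊥-elim (¬minimal-through-0P 1≤y 1≤x 1≤z (swap₁₂ R))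
line-bound α β (+ 0) _ _ _ 1≤x 1≤y 1≤z R = ⊥-elim (¬minimal-through-0P 1≤z 1≤x 1≤y (swap₁₂ (swap₂₃ R)))
line-bound +[1+ A ] +[1+ B ] +[1+ C ] _ _ _ 1≤x _ _ R = ⊥-elim (¬minimal-positive 1≤x R)
line-bound -[1+ A ] -[1+ B ] -[1+ C ] _ _ _ 1≤x _ _ R = ⊥-elim (¬minimal-positive 1≤x (negate R))
line-bound +[1+ A ] +[1+ B ] -[1+ C ] A<m B<m C<m _ _ _ R = axis-bound A<m B<m C<m R
line-bound -[1+ A ] -[1+ B ] +[1+ C ] A<m B<m C<m _ _ _ R = axis-bound A<m B<m C<m (negate R)
line-bound {m} {x} {y} {z} +[1+ A ] -[1+ B ] +[1+ C ] A<m B<m C<m _ _ _ R =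
  subst (_≤ 4 * m) (+-swap₂₃ x y z) (axis-bound A<m C<m B<m (swap₂₃ R))
line-bound {m} {x} {y} {z} -[1+ A ] +[1+ B ] -[1+ C ] A<m B<m C<m _ _ _ R =
  subst (_≤ 4 * m) (+-swap₂₃ x y z) (axis-bound A<m C<m B<m (swap₂₃ (negate R)))
line-bound {m} {x} {y} {z} -[1+ A ] +[1+ B ] +[1+ C ] A<m B<m C<m _ _ _ R =
  subst (_≤ 4 * m) (+-rotate x y z) (axis-bound B<m C<m A<m (swap₂₃ (swap₁₂ R)))
line-bound {m} {x} {y} {z} +[1+ A ] -[1+ B ] -[1+ C ] A<m B<m C<m _ _ _ R =
  subst (_≤ 4 * m) (+-rotate x y z) (axis-bound B<m C<m A<m (swap₂₃ (swap₁₂ (negate R))))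

∣i∣≤m : ∀ {m} i j → i *ᶻ i +ᶻ j *ᶻ j ≤ᶻ + m *ᶻ + m → ∣ i ∣ ≤ m
∣i∣≤m {m} i j i²+j²≤m² = ℕₚ.≮⇒≥ λ m<∣i∣ → ℕₚ.<⇒≱ (ℕₚ.*-mono-< m<∣i∣ m<∣i∣) ∣i∣²≤m²
  where
  ∣i∣²≤m² : ∣ i ∣ * ∣ i ∣ ≤ m * m
  ∣i∣²≤m² = ℤₚ.drop‿+≤+ (subst₂ _≤ᶻ_ (i*i≡∣i∣*∣i∣ i) (sym (ℤₚ.pos-* m m))
    (ℤₚ.≤-trans (i+j≡k⇒i≤k refl (0≤i*i j)) i²+j²≤m²))

∣j∣≤m : ∀ {m} i j → i *ᶻ i +ᶻ j *ᶻ j ≤ᶻ + m *ᶻ + m → ∣ j ∣ ≤ m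
∣j∣≤m i j = ∣i∣≤m j i ∘ subst (_≤ᶻ _) (ℤₚ.+-comm (i *ᶻ i) (j *ᶻ j))

collinear-comb : ∀ p q r a b c → cross c a ≡ + 0 → cross a b ≡ + 0 →
  proj₁ a *ᶻ proj₂ (comb p q r a b c) ≡ proj₂ a *ᶻ proj₁ (comb p q r a b c)
collinear-comb p q r a@(a₁ , a₂) b@(b₁ , b₂) c@(c₁ , c₂) d₂≡0 d₃≡0 = begin
  a₁ *ᶻ E₂                                              ≡⟨ eliminate (+ p) (+ q) (+ r) a₁ a₂ b₁ b₂ c₁ c₂ ⟩
  a₂ *ᶻ E₁ +ᶻ (+ q *ᶻ cross a b -ᶻ + r *ᶻ cross c a)    ≡⟨ cong₂ (λ s t → a₂ *ᶻ E₁ +ᶻ (+ q *ᶻ s -ᶻ + r *ᶻ t)) d₃≡0 d₂≡0 ⟩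
  a₂ *ᶻ E₁ +ᶻ (+ q *ᶻ + 0 -ᶻ + r *ᶻ + 0)                ≡⟨ vanish (a₂ *ᶻ E₁) (+ q) (+ r) ⟩
  a₂ *ᶻ E₁                                              ∎
  where
  open ≡-Reasoning
  E₁ = proj₁ (comb p q r a b c)
  E₂ = proj₂ (comb p q r a b c)
  eliminate : ∀ P Q R a₁ a₂ b₁ b₂ c₁ c₂ → a₁ *ᶻ (P *ᶻ a₂ +ᶻ (Q *ᶻ b₂ +ᶻ R *ᶻ c₂)) ≡
    a₂ *ᶻ (P *ᶻ a₁ +ᶻ (Q *ᶻ b₁ +ᶻ R *ᶻ c₁)) +ᶻ (Q *ᶻ (a₁ *ᶻ b₂ -ᶻ a₂ *ᶻ b₁) -ᶻ R *ᶻ (c₁ *ᶻ a₂ -ᶻ c₂ *ᶻ a₁))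
  eliminate = solveℤ
  vanish : ∀ k Q R → k +ᶻ (Q *ᶻ + 0 -ᶻ R *ᶻ + 0) ≡ k
  vanish = solveℤ

i*j≡0⇒j≡0 : ∀ {i j} → i ≢ + 0 → i *ᶻ j ≡ + 0 → j ≡ + 0
i*j≡0⇒j≡0 {i} i≢0 ij≡0 with ℤₚ.i*j≡0⇒i≡0∨j≡0 i ij≡0
... | inj₁ i≡0 = ⊥-elim (i≢0 i≡0)
... | inj₂ j≡0 = j≡0

project₁ : ∀ {a b c x y z} → proj₁ a ≢ + 0 → cross c a ≡ + 0 → cross a b ≡ + 0 →
  IsMinimalRelation a b c x y z → IsMinimalRelation (onAxis (proj₁ a)) (onAxis (proj₁ b)) (onAxis (proj₁ c)) x y z
project₁ {a} {b} {c} {x} {y} {z} a₁≢0 d₂≡0 d₃≡0 R = minimalRelation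
  (cong₂ _,_ (cong proj₁ (relation R)) (comb-onAxis₂ x y z (proj₁ a) (proj₁ b) (proj₁ c)))
  λ p q r p≤x q≤y r≤z 1≤pqr rel → minimal R p q r p≤x q≤y r≤z 1≤pqr (cong₂ _,_ (cong proj₁ rel)
    (i*j≡0⇒j≡0 a₁≢0 (trans (collinear-comb p q r a b c d₂≡0 d₃≡0)
                      (trans (cong (proj₂ a *ᶻ_) (cong proj₁ rel)) (ℤₚ.*-zeroʳ (proj₂ a))))))

project₂ : ∀ {a b c x y z} → proj₂ a ≢ + 0 → cross c a ≡ + 0 → cross a b ≡ + 0 →
  IsMinimalRelation a b c x y z → IsMinimalRelation (onAxis (proj₂ a)) (onAxis (proj₂ b)) (onAxis (proj₂ c)) x y z
project₂ {a} {b} {c} {x} {y} {z} a₂≢0 d₂≡0 d₃≡0 R = minimalRelation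
  (cong₂ _,_ (cong proj₂ (relation R)) (comb-onAxis₂ x y z (proj₂ a) (proj₂ b) (proj₂ c)))
  λ p q r p≤x q≤y r≤z 1≤pqr rel → minimal R p q r p≤x q≤y r≤z 1≤pqr (cong₂ _,_
    (i*j≡0⇒j≡0 a₂≢0 (trans (sym (collinear-comb p q r a b c d₂≡0 d₃≡0))
                      (trans (cong (proj₁ a *ᶻ_) (cong proj₁ rel)) (ℤₚ.*-zeroʳ (proj₁ a)))))
    (cong proj₁ rel))

collinear-bound : ∀ {m a b c x y z} → 1 ≤ x → 1 ≤ y → 1 ≤ z → InBall m a → InBall m b → InBall m c →
  IsMinimalRelation a b c x y z → cross b c ≡ + 0 → x + y + z ≤ 4 * m
collinear-bound {m} {a₁ , a₂} {b₁ , b₂} {c₁ , c₂} {x} {y} {z} 1≤x 1≤y 1≤z a∈B b∈B c∈B R d₁≡0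
  with collinear {x} {y} {z} (a₁ , a₂) (b₁ , b₂) (c₁ , c₂) 1≤x (relation R) d₁≡0 | a₁ ℤ.≟ + 0 | a₂ ℤ.≟ + 0
... | d₂≡0 , d₃≡0 | no a₁≢0 | _ = line-bound {m} a₁ b₁ c₁
  (∣i∣≤m a₁ a₂ a∈B) (∣i∣≤m b₁ b₂ b∈B) (∣i∣≤m c₁ c₂ c∈B) 1≤x 1≤y 1≤z (project₁ a₁≢0 d₂≡0 d₃≡0 R)
... | d₂≡0 , d₃≡0 | _ | no a₂≢0 = line-bound {m} a₂ b₂ c₂
  (∣j∣≤m a₁ a₂ a∈B) (∣j∣≤m b₁ b₂ b∈B) (∣j∣≤m c₁ c₂ c∈B) 1≤x 1≤y 1≤z (project₂ a₂≢0 d₂≡0 d₃≡0 R)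
... | _ | yes refl | yes refl = ⊥-elim (¬minimal-through-0P 1≤x 1≤y 1≤z R)

-- Minimal relations in the disc

≤4m⇒4L²≤27m⁴ : ∀ {m L} → 2 ≤ m → L ≤ 4 * m → 4 * (L * L) ≤ 27 * (m * m * (m * m))
≤4m⇒4L²≤27m⁴ {m} {L} 2≤m L≤4m = begin
  4 * (L * L)              ≤⟨ ℕₚ.*-monoʳ-≤ 4 (ℕₚ.*-mono-≤ L≤4m L≤4m) ⟩
  4 * (4 * m * (4 * m))    ≡⟨ regroup₁ m ⟩
  64 * (m * m)             ≤⟨ ℕₚ.*-monoˡ-≤ (m * m) (ℕₚ.≤-trans (ℕₚ.m≤m+n 64 44) (ℕₚ.*-monoʳ-≤ 27 (ℕₚ.*-mono-≤ 2≤m 2≤m))) ⟩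
  27 * (m * m) * (m * m)   ≡⟨ regroup₂ m ⟩
  27 * (m * m * (m * m))   ∎
  where
  open ℕₚ.≤-Reasoning
  regroup₁ : ∀ m → 4 * (4 * m * (4 * m)) ≡ 64 * (m * m)
  regroup₁ = solveℕ
  regroup₂ : ∀ m → 27 * (m * m) * (m * m) ≡ 27 * (m * m * (m * m))
  regroup₂ = solveℕ

minimal-relation-bound : ∀ {m a b c x y z} → 2 ≤ m → 1 ≤ x → 1 ≤ y → 1 ≤ z →
  InBall m a → InBall m b → InBall m c → IsMinimalRelation a b c x y z →
  4 * ((x + y + z) * (x + y + z)) ≤ 27 * (m * m * (m * m))
minimal-relation-bound {m} {a} {b} {c} {x} {y} {z} 2≤m 1≤x 1≤y 1≤z a∈B b∈B c∈B R with ∣ cross b c ∣ in ∣d₁∣≡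
... | suc _ = ℕₚ.≤-trans (ℕₚ.*-monoʳ-≤ 4 (ℕₚ.*-mono-≤ L≤∣Δ∣ L≤∣Δ∣)) (doubleArea-bound {m} a b c a∈B b∈B c∈B)
  where L≤∣Δ∣ = noncollinear-bound 1≤x R (subst (1 ≤_) (sym ∣d₁∣≡) (s≤s z≤n))
... | zero = ≤4m⇒4L²≤27m⁴ 2≤m (collinear-bound {m} 1≤x 1≤y 1≤z a∈B b∈B c∈B R (ℤₚ.∣i∣≡0⇒i≡0 ∣d₁∣≡))

-- Sequences supported on three points

multiplicity : Point → Seq → ℕ
multiplicity a [] = 0
multiplicity a (e ∷ S) with e ≟P a
... | yes _ = suc (multiplicity a S)
... | no _ = multiplicity a S

multiplicity-≡ : ∀ a S → multiplicity a (a ∷ S) ≡ suc (multiplicity a S)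
multiplicity-≡ a S with a ≟P a
... | yes _ = refl
... | no a≢a = ⊥-elim (a≢a refl)

multiplicity-≢ : ∀ {a e} S → e ≢ a → multiplicity a (e ∷ S) ≡ multiplicity a S
multiplicity-≢ {a} {e} S e≢a with e ≟P a
... | yes e≡a = ⊥-elim (e≢a e≡a)
... | no _ = refl

multiplicity-∷ : ∀ a e S → multiplicity a S ≤ multiplicity a (e ∷ S)
multiplicity-∷ a e S with e ≟P a
... | yes _ = ℕₚ.n≤1+n _
... | no _ = ℕₚ.≤-refl

multiplicity-mono : ∀ a {T S} → T ⊆ S → multiplicity a T ≤ multiplicity a S
multiplicity-mono a [] = z≤n
multiplicity-mono a (_∷ʳ_ {T} {S} e T⊆S) = ℕₚ.≤-trans (multiplicity-mono a T⊆S) (multiplicity-∷ a e S)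
multiplicity-mono a (_∷_ {e} refl T⊆S) with e ≟P a
... | yes _ = s≤s (multiplicity-mono a T⊆S)
... | no _ = multiplicity-mono a T⊆S

multiplicity-∈ : ∀ {a S} → a ∈ S → 1 ≤ multiplicity a S
multiplicity-∈ {a} {.a ∷ S} (here refl) = subst (1 ≤_) (sym (multiplicity-≡ a S)) (s≤s z≤n)
multiplicity-∈ {a} {e ∷ S} (there a∈S) = ℕₚ.≤-trans (multiplicity-∈ a∈S) (multiplicity-∷ a e S)

multiplicity-++ : ∀ a S T → multiplicity a (S ++ T) ≡ multiplicity a S + multiplicity a T
multiplicity-++ a [] T = refl
multiplicity-++ a (e ∷ S) T with e ≟P a
... | yes _ = cong suc (multiplicity-++ a S T)
... | no _ = multiplicity-++ a S T

multiplicity-replicate-≡ : ∀ a n → multiplicity a (replicate n a) ≡ n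
multiplicity-replicate-≡ a zero = refl
multiplicity-replicate-≡ a (suc n) = trans (multiplicity-≡ a (replicate n a)) (cong suc (multiplicity-replicate-≡ a n))

multiplicity-replicate-≢ : ∀ {a e} n → e ≢ a → multiplicity a (replicate n e) ≡ 0
multiplicity-replicate-≢ zero _ = refl
multiplicity-replicate-≢ {a} {e} (suc n) e≢a = trans (multiplicity-≢ (replicate n e) e≢a) (multiplicity-replicate-≢ n e≢a)

comb-suc₁ : ∀ p q r a b c → comb (suc p) q r a b c ≡ a +P comb p q r a b c
comb-suc₁ p q r (a₁ , a₂) (b₁ , b₂) (c₁ , c₂) = cong₂ _,_ (shift (+ p) a₁ (+ q *ᶻ b₁) (+ r *ᶻ c₁)) (shift (+ p) a₂ (+ q *ᶻ b₂) (+ r *ᶻ c₂))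
  where shift : ∀ P a X Y → (+ 1 +ᶻ P) *ᶻ a +ᶻ (X +ᶻ Y) ≡ a +ᶻ (P *ᶻ a +ᶻ (X +ᶻ Y))
        shift = solveℤ

comb-suc₂ : ∀ p q r a b c → comb p (suc q) r a b c ≡ b +P comb p q r a b c
comb-suc₂ p q r (a₁ , a₂) (b₁ , b₂) (c₁ , c₂) = cong₂ _,_ (shift (+ q) b₁ (+ p *ᶻ a₁) (+ r *ᶻ c₁)) (shift (+ q) b₂ (+ p *ᶻ a₂) (+ r *ᶻ c₂))
  where shift : ∀ Q b X Y → X +ᶻ ((+ 1 +ᶻ Q) *ᶻ b +ᶻ Y) ≡ b +ᶻ (X +ᶻ (Q *ᶻ b +ᶻ Y))
        shift = solveℤ

comb-suc₃ : ∀ p q r a b c → comb p q (suc r) a b c ≡ c +P comb p q r a b c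
comb-suc₃ p q r (a₁ , a₂) (b₁ , b₂) (c₁ , c₂) = cong₂ _,_ (shift (+ r) c₁ (+ p *ᶻ a₁) (+ q *ᶻ b₁)) (shift (+ r) c₂ (+ p *ᶻ a₂) (+ q *ᶻ b₂))
  where shift : ∀ R c X Y → X +ᶻ (Y +ᶻ (+ 1 +ᶻ R) *ᶻ c) ≡ c +ᶻ (X +ᶻ (Y +ᶻ R *ᶻ c))
        shift = solveℤ

Over : Point → Point → Point → Seq → Set
Over a b c = All (_∈ a ∷ b ∷ c ∷ [])

module ThreePoints {a b c : Point} (a≢b : a ≢ b) (a≢c : a ≢ c) (b≢c : b ≢ c) where

  #a #b #c : Seq → ℕ
  #a = multiplicity a
  #b = multiplicity b
  #c = multiplicity c

  private
    b≢a = a≢b ∘ sym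
    c≢a = a≢c ∘ sym
    c≢b = b≢c ∘ sym

  length-over : ∀ {S} → Over a b c S → length S ≡ #a S + #b S + #c S
  length-over [] = refl
  length-over {.a ∷ S} (here refl ∷ over)
    rewrite multiplicity-≡ a S | multiplicity-≢ S a≢b | multiplicity-≢ S a≢c = cong suc (length-over over)
  length-over {.b ∷ S} (there (here refl) ∷ over)
    rewrite multiplicity-≢ S b≢a | multiplicity-≡ b S | multiplicity-≢ S b≢c =
    trans (cong suc (length-over over)) (sym (cong (_+ #c S) (ℕₚ.+-suc (#a S) (#b S))))
  length-over {.c ∷ S} (there (there (here refl)) ∷ over)
    rewrite multiplicity-≢ S c≢a | multiplicity-≢ S c≢b | multiplicity-≡ c S =
    trans (cong suc (length-over over)) (sym (ℕₚ.+-suc (#a S + #b S) (#c S)))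

  σ-over : ∀ {S} → Over a b c S → σ S ≡ comb (#a S) (#b S) (#c S) a b c
  σ-over [] = refl
  σ-over {.a ∷ S} (here refl ∷ over)
    rewrite multiplicity-≡ a S | multiplicity-≢ S a≢b | multiplicity-≢ S a≢c =
    trans (cong (a +P_) (σ-over over)) (sym (comb-suc₁ (#a S) (#b S) (#c S) a b c))
  σ-over {.b ∷ S} (there (here refl) ∷ over)
    rewrite multiplicity-≢ S b≢a | multiplicity-≡ b S | multiplicity-≢ S b≢c =
    trans (cong (b +P_) (σ-over over)) (sym (comb-suc₂ (#a S) (#b S) (#c S) a b c))
  σ-over {.c ∷ S} (there (there (here refl)) ∷ over)
    rewrite multiplicity-≢ S c≢a | multiplicity-≢ S c≢b | multiplicity-≡ c S =
    trans (cong (c +P_) (σ-over over)) (sym (comb-suc₃ (#a S) (#b S) (#c S) a b c))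

  record SublistWith (S : Seq) (p q r : ℕ) : Set where
    constructor sublist
    field
      {T} : Seq
      T⊆S : T ⊆ S
      length-T : length T ≡ p + q + r
      σ-T : σ T ≡ comb p q r a b c

  private
    skip : ∀ e {S p q r} → SublistWith S p q r → SublistWith (e ∷ S) p q r
    skip e (sublist T⊆S len sum) = sublist (e ∷ʳ T⊆S) len sum

    take₁ : ∀ {S p q r} → SublistWith S p q r → SublistWith (a ∷ S) (suc p) q r
    take₁ {p = p} {q} {r} (sublist T⊆S len sum) =
      sublist (refl ∷ T⊆S) (cong suc len) (trans (cong (a +P_) sum) (sym (comb-suc₁ p q r a b c)))

    take₂ : ∀ {S p q r} → SublistWith S p q r → SublistWith (b ∷ S) p (suc q) r
    take₂ {p = p} {q} {r} (sublist T⊆S len sum) =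
      sublist (refl ∷ T⊆S) (trans (cong suc len) (sym (cong (_+ r) (ℕₚ.+-suc p q))))
        (trans (cong (b +P_) sum) (sym (comb-suc₂ p q r a b c)))

    take₃ : ∀ {S p q r} → SublistWith S p q r → SublistWith (c ∷ S) p q (suc r)
    take₃ {p = p} {q} {r} (sublist T⊆S len sum) =
      sublist (refl ∷ T⊆S) (trans (cong suc len) (sym (ℕₚ.+-suc (p + q) r)))
        (trans (cong (c +P_) sum) (sym (comb-suc₃ p q r a b c)))

  sublistWith : ∀ {S} → Over a b c S → ∀ {p q r} → p ≤ #a S → q ≤ #b S → r ≤ #c S → SublistWith S p q r
  sublistWith [] z≤n z≤n z≤n = sublist [] refl refl
  sublistWith {.a ∷ S} (here refl ∷ over) {p} {q} {r} p≤ q≤ r≤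
    with subst (p ≤_) (multiplicity-≡ a S) p≤
  ... | z≤n = skip a (sublistWith over z≤n (subst (q ≤_) (multiplicity-≢ S a≢b) q≤) (subst (r ≤_) (multiplicity-≢ S a≢c) r≤))
  ... | s≤s p′≤ = take₁ (sublistWith over p′≤ (subst (q ≤_) (multiplicity-≢ S a≢b) q≤) (subst (r ≤_) (multiplicity-≢ S a≢c) r≤))
  sublistWith {.b ∷ S} (there (here refl) ∷ over) {p} {q} {r} p≤ q≤ r≤
    with subst (q ≤_) (multiplicity-≡ b S) q≤
  ... | z≤n = skip b (sublistWith over (subst (p ≤_) (multiplicity-≢ S b≢a) p≤) z≤n (subst (r ≤_) (multiplicity-≢ S b≢c) r≤))
  ... | s≤s q′≤ = take₂ (sublistWith over (subst (p ≤_) (multiplicity-≢ S b≢a) p≤) q′≤ (subst (r ≤_) (multiplicity-≢ S b≢c) r≤))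
  sublistWith {.c ∷ S} (there (there (here refl)) ∷ over) {p} {q} {r} p≤ q≤ r≤
    with subst (r ≤_) (multiplicity-≡ c S) r≤
  ... | z≤n = skip c (sublistWith over (subst (p ≤_) (multiplicity-≢ S c≢a) p≤) (subst (q ≤_) (multiplicity-≢ S c≢b) q≤) z≤n)
  ... | s≤s r′≤ = take₃ (sublistWith over (subst (p ≤_) (multiplicity-≢ S c≢a) p≤) (subst (q ≤_) (multiplicity-≢ S c≢b) q≤) r′≤)

  private
    ≠ : (d e : Point) → Dec (¬ d ≡ e)
    ≠ d = ¬? ∘ (d ≟P_)
    ≠a = ≠ a
    ≠b = ≠ b
    ≠c = ≠ c

  filter-out : ∀ {D} → Over a b c D → filter ≠a (filter ≠b (filter ≠c D)) ≡ []
  filter-out [] = refl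
  filter-out {.a ∷ D} (here refl ∷ over)
    rewrite Listₚ.filter-accept ≠c {a} {D} c≢a
          | Listₚ.filter-accept ≠b {a} {filter ≠c D} b≢a
          | Listₚ.filter-reject ≠a {a} {filter ≠b (filter ≠c D)} (λ a≢a → a≢a refl) = filter-out over
  filter-out {.b ∷ D} (there (here refl) ∷ over)
    rewrite Listₚ.filter-accept ≠c {b} {D} c≢b
          | Listₚ.filter-reject ≠b {b} {filter ≠c D} (λ b≢b → b≢b refl) = filter-out over
  filter-out {.c ∷ D} (there (there (here refl)) ∷ over)
    rewrite Listₚ.filter-reject ≠c {c} {D} (λ c≢c → c≢c refl) = filter-out over

  supportSize-over : ∀ {S} → Over a b c S → supportSize (a ∷ b ∷ c ∷ S) ≡ 3
  supportSize-over {S} over = cong length (begin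
    a ∷ filter ≠a (b ∷ filter ≠b (c ∷ filter ≠c D))        ≡⟨ cong (λ t → a ∷ filter ≠a (b ∷ t)) (Listₚ.filter-accept ≠b b≢c) ⟩
    a ∷ filter ≠a (b ∷ c ∷ filter ≠b (filter ≠c D))        ≡⟨ cong (a ∷_) (Listₚ.filter-accept ≠a a≢b) ⟩
    a ∷ b ∷ filter ≠a (c ∷ filter ≠b (filter ≠c D))        ≡⟨ cong (λ t → a ∷ b ∷ t) (Listₚ.filter-accept ≠a a≢c) ⟩
    a ∷ b ∷ c ∷ filter ≠a (filter ≠b (filter ≠c D))        ≡⟨ cong (λ t → a ∷ b ∷ c ∷ t) (filter-out (Allₚ.deduplicate⁺ _≟P_ over)) ⟩
    a ∷ b ∷ c ∷ []                                          ∎)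
    where
    open ≡-Reasoning
    D = deduplicate _≟P_ S

  -- a, b, c come first so that deduplicate returns exactly a ∷ b ∷ c ∷ [].
  canonical : ℕ → ℕ → ℕ → Seq
  canonical x y z = a ∷ b ∷ c ∷ replicate x a ++ replicate y b ++ replicate z c

  over-replicates : ∀ x y z → Over a b c (replicate x a ++ replicate y b ++ replicate z c)
  over-replicates x y z = Allₚ.++⁺ (Allₚ.replicate⁺ x (here refl))
    (Allₚ.++⁺ (Allₚ.replicate⁺ y (there (here refl))) (Allₚ.replicate⁺ z (there (there (here refl)))))

  over-canonical : ∀ x y z → Over a b c (canonical x y z)
  over-canonical x y z = here refl ∷ there (here refl) ∷ there (there (here refl)) ∷ over-replicates x y z

  private
    multiplicity-canonical : ∀ e x y z → multiplicity e (canonical x y z) ≡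
      multiplicity e (a ∷ b ∷ c ∷ []) + (multiplicity e (replicate x a) + (multiplicity e (replicate y b) + multiplicity e (replicate z c)))
    multiplicity-canonical e x y z = trans (multiplicity-++ e (a ∷ b ∷ c ∷ []) _)
      (cong (_+_ _) (trans (multiplicity-++ e (replicate x a) _) (cong (_+_ _) (multiplicity-++ e (replicate y b) _))))

  #a-canonical : ∀ x y z → #a (canonical x y z) ≡ suc x
  #a-canonical x y z = begin
    #a (canonical x y z)                  ≡⟨ multiplicity-canonical a x y z ⟩
    #a (a ∷ b ∷ c ∷ []) + (#a (replicate x a) + (#a (replicate y b) + #a (replicate z c)))
      ≡⟨ cong₂ _+_ (trans (multiplicity-≡ a _) (cong suc (trans (multiplicity-≢ _ b≢a) (multiplicity-≢ [] c≢a))))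
                   (cong₂ _+_ (multiplicity-replicate-≡ a x) (cong₂ _+_ (multiplicity-replicate-≢ y b≢a) (multiplicity-replicate-≢ z c≢a))) ⟩
    1 + (x + 0)                           ≡⟨ cong suc (ℕₚ.+-identityʳ x) ⟩
    suc x                                 ∎
    where open ≡-Reasoning

  #b-canonical : ∀ x y z → #b (canonical x y z) ≡ suc y
  #b-canonical x y z = begin
    #b (canonical x y z)                  ≡⟨ multiplicity-canonical b x y z ⟩
    #b (a ∷ b ∷ c ∷ []) + (#b (replicate x a) + (#b (replicate y b) + #b (replicate z c)))
      ≡⟨ cong₂ _+_ (trans (multiplicity-≢ _ a≢b) (trans (multiplicity-≡ b _) (cong suc (multiplicity-≢ [] c≢b))))
                   (cong₂ _+_ (multiplicity-replicate-≢ x a≢b) (cong₂ _+_ (multiplicity-replicate-≡ b y) (multiplicity-replicate-≢ z c≢b))) ⟩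
    1 + (y + 0)                           ≡⟨ cong suc (ℕₚ.+-identityʳ y) ⟩
    suc y                                 ∎
    where open ≡-Reasoning

  #c-canonical : ∀ x y z → #c (canonical x y z) ≡ suc z
  #c-canonical x y z = begin
    #c (canonical x y z)                  ≡⟨ multiplicity-canonical c x y z ⟩
    #c (a ∷ b ∷ c ∷ []) + (#c (replicate x a) + (#c (replicate y b) + #c (replicate z c)))
      ≡⟨ cong₂ _+_ (trans (multiplicity-≢ _ a≢c) (trans (multiplicity-≢ _ b≢c) (multiplicity-≡ c [])))
                   (cong₂ _+_ (multiplicity-replicate-≢ x a≢c) (cong₂ _+_ (multiplicity-replicate-≢ y b≢c) (multiplicity-replicate-≡ c z))) ⟩
    1 + z                                 ∎
    where open ≡-Reasoning

record ThreeElementSupport (S : Seq) : Set where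
  constructor threeElementSupport
  field
    {a b c} : Point
    a≢b : a ≢ b
    a≢c : a ≢ c
    b≢c : b ≢ c
    a∈S : a ∈ S
    b∈S : b ∈ S
    c∈S : c ∈ S
    over : Over a b c S

supportSize≡3⇒threeElementSupport : ∀ S → supportSize S ≡ 3 → ThreeElementSupport S
supportSize≡3⇒threeElementSupport S _ with deduplicate _≟P_ S in dedup≡ | Uniqueₚ.deduplicate-! _≟P_ S
... | a ∷ b ∷ c ∷ [] | (a≢b ∷ a≢c ∷ []) ∷ (b≢c ∷ []) ∷ [] ∷ [] =
  threeElementSupport a≢b a≢c b≢c (∈S (here refl)) (∈S (there (here refl))) (∈S (there (there (here refl))))
    (All.tabulate (subst (_ ∈_) dedup≡ ∘ ∈-deduplicate⁺ _≟P_))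
  where
  ∈S : ∀ {e} → e ∈ a ∷ b ∷ c ∷ [] → e ∈ S
  ∈S = ∈-deduplicate⁻ _≟P_ S ∘ subst (_ ∈_) (sym dedup≡)

record MinimalRelationIn (m L : ℕ) : Set where
  constructor minimalRelationIn
  field
    {a b c} : Point
    a≢b : a ≢ b
    a≢c : a ≢ c
    b≢c : b ≢ c
    a∈B : InBall m a
    b∈B : InBall m b
    c∈B : InBall m c
    {x y z} : ℕ
    1≤x : 1 ≤ x
    1≤y : 1 ≤ y
    1≤z : 1 ≤ z
    x+y+z≡L : x + y + z ≡ L
    isMinimalRelation : IsMinimalRelation a b c x y z

achievable⇒minimalRelationIn : ∀ {m L} → Achievable3 m L → MinimalRelationIn m L
achievable⇒minimalRelationIn (S , S∈B , (zero-sum , _ , no-shorter) , supportSize≡3 , refl)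
  with supportSize≡3⇒threeElementSupport S supportSize≡3
... | threeElementSupport {a} {b} {c} a≢b a≢c b≢c a∈S b∈S c∈S over =
  minimalRelationIn a≢b a≢c b≢c (All.lookup S∈B a∈S) (All.lookup S∈B b∈S) (All.lookup S∈B c∈S)
    (multiplicity-∈ a∈S) (multiplicity-∈ b∈S) (multiplicity-∈ c∈S) (sym (length-over over))
    (minimalRelation (trans (sym (σ-over over)) zero-sum) no-shorter-relation)
  where
  open ThreePoints a≢b a≢c b≢c
  no-shorter-relation : ∀ p q r → p ≤ #a S → q ≤ #b S → r ≤ #c S → 1 ≤ p + q + r →
    comb p q r a b c ≡ 0P → #a S + #b S + #c S ≤ p + q + r
  no-shorter-relation p q r p≤ q≤ r≤ 1≤pqr rel with sublistWith over p≤ q≤ r≤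
  ... | sublist {T} T⊆S length-T σ-T = ℕₚ.≮⇒≥ λ shorter →
    no-shorter T T⊆S T≢[] (subst₂ _<_ (sym length-T) (sym (length-over over)) shorter) (trans σ-T rel)
    where
    T≢[] : T ≢ []
    T≢[] refl = ℕₚ.<⇒≱ 1≤pqr (ℕₚ.≤-reflexive (sym length-T))

minimalRelationIn⇒achievable : ∀ {m L} → MinimalRelationIn m L → Achievable3 m L
minimalRelationIn⇒achievable {m} (minimalRelationIn {a} {b} {c} a≢b a≢c b≢c a∈B b∈B c∈B
                                    {suc x} {suc y} {suc z} _ _ _ refl R) =
  S , S∈B , (zero-sum , (λ ()) , no-shorter) , supportSize-over (over-replicates x y z) , length-S
  where
  open ThreePoints a≢b a≢c b≢c
  S = canonical x y z
  over = over-canonical x y z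
  S∈B : All (InBall m) S
  S∈B = a∈B ∷ b∈B ∷ c∈B ∷ Allₚ.++⁺ (Allₚ.replicate⁺ x a∈B) (Allₚ.++⁺ (Allₚ.replicate⁺ y b∈B) (Allₚ.replicate⁺ z c∈B))
  zero-sum : σ S ≡ 0P
  zero-sum = begin
    σ S                                   ≡⟨ σ-over over ⟩
    comb (#a S) (#b S) (#c S) a b c       ≡⟨ cong₂ (λ p (qr : ℕ × ℕ) → comb p (proj₁ qr) (proj₂ qr) a b c)
                                               (#a-canonical x y z) (cong₂ _,_ (#b-canonical x y z) (#c-canonical x y z)) ⟩
    comb (suc x) (suc y) (suc z) a b c    ≡⟨ relation R ⟩
    0P                                    ∎
    where open ≡-Reasoning
  length-S : length S ≡ suc x + suc y + suc z
  length-S = trans (length-over over)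
    (cong₂ _+_ (cong₂ _+_ (#a-canonical x y z) (#b-canonical x y z)) (#c-canonical x y z))
  no-shorter : ∀ T → T ⊆ S → T ≢ [] → length T < length S → ¬ ZeroSum T
  no-shorter T T⊆S T≢[] shorter zero-sum-T = ℕₚ.<⇒≱ (subst₂ _<_ length-T length-S shorter)
    (minimal R (#a T) (#b T) (#c T) (bounded a (#a-canonical x y z)) (bounded b (#b-canonical x y z))
      (bounded c (#c-canonical x y z)) (subst (1 ≤_) length-T (nonempty T≢[]))
      (trans (sym (σ-over over-T)) zero-sum-T))
    where
    over-T = All-resp-⊆ T⊆S over
    length-T = length-over over-T
    bounded : ∀ e {n} → multiplicity e S ≡ n → multiplicity e T ≤ n
    bounded e eq = subst (_ ≤_) eq (multiplicity-mono e T⊆S)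
    nonempty : ∀ {T : Seq} → T ≢ [] → 1 ≤ length T
    nonempty {[]} T≢[] = ⊥-elim (T≢[] refl)
    nonempty {_ ∷ _} _ = s≤s z≤n

achievable⇔minimalRelationIn : ∀ {m L} → Achievable3 m L ⇔ MinimalRelationIn m L
achievable⇔minimalRelationIn = mk⇔ achievable⇒minimalRelationIn minimalRelationIn⇒achievable

-- An extremal configuration

consecutive-proportion : ∀ X r p → 1 ≤ X → r * suc X ≡ p * X → r ≤ X → (r ≡ 0 × p ≡ 0) ⊎ (r ≡ X × p ≡ suc X)
consecutive-proportion X r p 1≤X eq r≤X with p ≤? r
... | yes p≤r = inj₁ (r≡0 , p≡0)
  where
  r≡0 : r ≡ 0
  r≡0 = ℕₚ.n≤0⇒n≡0 (ℕₚ.+-cancelʳ-≤ (r * X) r 0 (begin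
    r + r * X  ≡⟨ sym (ℕₚ.*-suc r X) ⟩
    r * suc X  ≡⟨ eq ⟩
    p * X      ≤⟨ ℕₚ.*-monoˡ-≤ X p≤r ⟩
    r * X      ∎))
    where open ℕₚ.≤-Reasoning
  p≡0 : p ≡ 0
  p≡0 with ℕₚ.m*n≡0⇒m≡0∨n≡0 p (trans (sym eq) (cong (_* suc X) r≡0))
  ... | inj₁ p≡0 = p≡0
  ... | inj₂ X≡0 = ⊥-elim (ℕₚ.<⇒≢ 1≤X (sym X≡0))
... | no p≰r = inj₂ (r≡X , p≡1+X)
  where
  r≡X : r ≡ X
  r≡X = ℕₚ.≤-antisym r≤X (ℕₚ.+-cancelʳ-≤ (r * X) X r (begin
    X + r * X  ≡⟨⟩
    suc r * X  ≤⟨ ℕₚ.*-monoˡ-≤ X (ℕₚ.≰⇒> p≰r) ⟩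
    p * X      ≡⟨ sym eq ⟩
    r * suc X  ≡⟨ ℕₚ.*-suc r X ⟩
    r + r * X  ∎))
    where open ℕₚ.≤-Reasoning
  p≡1+X : p ≡ suc X
  p≡1+X = ℕₚ.*-cancelʳ-≡ p (suc X) X {{ℕ.>-nonZero 1≤X}}
    (trans (sym eq) (trans (cong (_* suc X) r≡X) (ℕₚ.*-comm X (suc X))))

module Construction (h t : ℕ) where

  A B C : Point
  A = + t , + h
  B = + 1 , -[1+ 2 * h ]
  C = -[1+ t ] , + h

  X Y : ℕ
  X = 2 * h * t + t + h
  Y = 2 * h * t + h

  A≢B : A ≢ B
  A≢B A≡B with cong proj₂ A≡B
  ... | ()

  A≢C : A ≢ C
  A≢C A≡C with cong proj₁ A≡C
  ... | ()

  B≢C : B ≢ C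
  B≢C B≡C with cong proj₂ B≡C
  ... | ()

  first-coordinate : ∀ p q r → (proj₁ (comb p q r A B C) ≡ + 0) ⇔ (p * t + q * 1 ≡ r * suc t)
  first-coordinate p q r = balance p q r t 1 (suc t)

  second-coordinate : ∀ p q r → (proj₂ (comb p q r A B C) ≡ + 0) ⇔ (p * h + r * h ≡ q * suc (2 * h))
  second-coordinate p q r = mk⇔ (to ∘ trans (sym reorder)) (trans reorder ∘ from)
    where
    open Equivalence (balance p r q h h (suc (2 * h)))
    reorder : proj₂ (comb p q r A B C) ≡ + p *ᶻ + h +ᶻ (+ r *ᶻ + h +ᶻ + q *ᶻ -[1+ 2 * h ])
    reorder = cong (+ p *ᶻ + h +ᶻ_) (ℤₚ.+-comm (+ q *ᶻ -[1+ 2 * h ]) (+ r *ᶻ + h))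

  relation-ABC : comb (suc X) Y X A B C ≡ 0P
  relation-ABC = cong₂ _,_ (Equivalence.from (first-coordinate (suc X) Y X) (first h t))
                           (Equivalence.from (second-coordinate (suc X) Y X) (second h t))
    where
    first : ∀ h t → suc (2 * h * t + t + h) * t + (2 * h * t + h) * 1 ≡ (2 * h * t + t + h) * suc t
    first = solveℕ
    second : ∀ h t → suc (2 * h * t + t + h) * h + (2 * h * t + t + h) * h ≡ (2 * h * t + h) * suc (2 * h)
    second = solveℕ

  minimal-ABC : 1 ≤ h → IsMinimalRelation A B C (suc X) Y X
  minimal-ABC 1≤h = minimalRelation relation-ABC λ p q r p≤ q≤ r≤ 1≤pqr rel →
    only-full p q r r≤ 1≤pqr (Equivalence.to (first-coordinate p q r) (cong proj₁ rel))
                             (Equivalence.to (second-coordinate p q r) (cong proj₂ rel))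
    where
    1≤X : 1 ≤ X
    1≤X = ℕₚ.≤-trans 1≤h (ℕₚ.m≤n+m h (2 * h * t + t))
    only-full : ∀ p q r → r ≤ X → 1 ≤ p + q + r → p * t + q * 1 ≡ r * suc t →
      p * h + r * h ≡ q * suc (2 * h) → suc X + Y + X ≤ p + q + r
    only-full p q r r≤X 1≤pqr first second
      with consecutive-proportion X r p 1≤X (ℕₚ.+-cancelʳ-≡ (r * h) (r * suc X) (p * X) cross-multiplied) r≤X
      where
      open ≡-Reasoning
      -- q is eliminated between the two coordinates
      cross-multiplied : r * suc X + r * h ≡ p * X + r * h
      cross-multiplied = begin
        r * suc X + r * h                       ≡⟨ expand h t r ⟩
        r * suc t * suc (2 * h)                 ≡⟨ cong (_* suc (2 * h)) (sym first) ⟩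
        (p * t + q * 1) * suc (2 * h)           ≡⟨ distribute h t p q ⟩
        p * t * suc (2 * h) + q * suc (2 * h)   ≡⟨ cong (_+_ (p * t * suc (2 * h))) (sym second) ⟩
        p * t * suc (2 * h) + (p * h + r * h)   ≡⟨ collect h t p r ⟩
        p * X + r * h                           ∎
        where
        expand : ∀ h t r → r * suc (2 * h * t + t + h) + r * h ≡ r * suc t * suc (2 * h)
        expand = solveℕ
        distribute : ∀ h t p q → (p * t + q * 1) * suc (2 * h) ≡ p * t * suc (2 * h) + q * suc (2 * h)
        distribute = solveℕ
        collect : ∀ h t p r → p * t * suc (2 * h) + (p * h + r * h) ≡ p * (2 * h * t + t + h) + r * h
        collect = solveℕ
    ... | inj₁ (refl , refl) = ⊥-elim (ℕₚ.<⇒≢ 1≤pqr (sym (trans (ℕₚ.+-identityʳ q) (trans (sym (ℕₚ.*-identityʳ q)) first))))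
    ... | inj₂ (refl , refl) = ℕₚ.≤-reflexive (cong (λ q → suc X + q + X) (sym q≡Y))
      where
      q≡Y : q ≡ Y
      q≡Y = trans (sym (ℕₚ.*-identityʳ q)) (ℕₚ.+-cancelˡ-≡ (suc X * t) (q * 1) Y (trans first (complement h t)))
        where complement : ∀ h t → (2 * h * t + t + h) * suc t ≡ suc (2 * h * t + t + h) * t + (2 * h * t + h)
              complement = solveℕ

-- The asymptotic bounds

*-self-mono-≤ : ∀ {a b} → a ≤ b → a * a ≤ b * b
*-self-mono-≤ a≤b = ℕₚ.*-mono-≤ a≤b a≤b

3m²≤4[2+t]² : ∀ {h t m} → 2 * h ≤ m → m * m < (2 + t) * (2 + t) + h * h → 3 * (m * m) ≤ 4 * ((2 + t) * (2 + t))
3m²≤4[2+t]² {h} {t} {m} 2h≤m m²<T²+h² = ℕₚ.+-cancelʳ-≤ (m * m) (3 * (m * m)) (4 * T²) (begin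
  3 * (m * m) + m * m       ≡⟨ ℕₚ.+-comm (3 * (m * m)) (m * m) ⟩
  4 * (m * m)               ≤⟨ ℕₚ.*-monoʳ-≤ 4 (ℕₚ.<⇒≤ m²<T²+h²) ⟩
  4 * (T² + h * h)          ≡⟨ ℕₚ.*-distribˡ-+ 4 T² (h * h) ⟩
  4 * T² + 4 * (h * h)      ≤⟨ ℕₚ.+-monoʳ-≤ (4 * T²) (subst (_≤ m * m) (four-squares h) (*-self-mono-≤ 2h≤m)) ⟩
  4 * T² + m * m            ∎)
  where
  open ℕₚ.≤-Reasoning
  T² = (2 + t) * (2 + t)
  four-squares : ∀ h → 2 * h * (2 * h) ≡ 4 * (h * h)
  four-squares = solveℕ

h≤1+t : ∀ {h t m} → 2 * h ≤ m → m * m < (2 + t) * (2 + t) + h * h → h ≤ 1 + t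
h≤1+t {h} {t} {m} 2h≤m m²<T²+h² = ℕₚ.≮⇒≥ λ 1+t<h → ℕₚ.<⇒≱ h²<T² (*-self-mono-≤ 1+t<h)
  where
  h²<T² : h * h < (2 + t) * (2 + t)
  h²<T² = ℕₚ.+-cancelʳ-< (h * h) (h * h) ((2 + t) * (2 + t)) (ℕₚ.≤-<-trans (begin
    h * h + h * h    ≤⟨ ℕₚ.m≤m+n (h * h + h * h) (h * h + h * h) ⟩
    h * h + h * h + (h * h + h * h) ≡⟨ four-squares h ⟩
    2 * h * (2 * h)  ≤⟨ *-self-mono-≤ 2h≤m ⟩
    m * m            ∎) m²<T²+h²)
    where
    open ℕₚ.≤-Reasoning
    four-squares : ∀ h → h * h + h * h + (h * h + h * h) ≡ 2 * h * (2 * h)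
    four-squares = solveℕ

k[2h+3][2+t]≤[k+1]2ht : ∀ k h t → 4 * k + 8 ≤ h → h ≤ 1 + t → k * (2 * h + 3) * (2 + t) ≤ (k + 1) * (2 * h * t)
k[2h+3][2+t]≤[k+1]2ht k h t 4k+8≤h h≤1+t = begin
  k * (2 * h + 3) * (2 + t)                           ≡⟨ expand k h t ⟩
  2 * k * h * t + (4 * k * h + 6 * k + 3 * k * t)     ≤⟨ ℕₚ.+-monoʳ-≤ (2 * k * h * t) (ℕₚ.+-mono-≤ 4kh+6k≤ht 3kt≤ht) ⟩
  2 * k * h * t + (h * t + h * t)                     ≡⟨ collect k h t ⟩
  (k + 1) * (2 * h * t)                               ∎
  where
  open ℕₚ.≤-Reasoning
  expand : ∀ k h t → k * (2 * h + 3) * (2 + t) ≡ 2 * k * h * t + (4 * k * h + 6 * k + 3 * k * t)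
  expand = solveℕ
  collect : ∀ k h t → 2 * k * h * t + (h * t + h * t) ≡ (k + 1) * (2 * h * t)
  collect = solveℕ
  k≤h : k ≤ h
  k≤h = ℕₚ.≤-trans (ℕₚ.≤-trans (ℕₚ.m≤n*m k 4) (ℕₚ.m≤m+n (4 * k) 8)) 4k+8≤h
  3kt≤ht : 3 * k * t ≤ h * t
  3kt≤ht = ℕₚ.*-monoˡ-≤ t (ℕₚ.≤-trans (ℕₚ.≤-trans (ℕₚ.*-monoˡ-≤ k (ℕₚ.n≤1+n 3)) (ℕₚ.m≤m+n (4 * k) 8)) 4k+8≤h)
  4kh+6k≤ht : 4 * k * h + 6 * k ≤ h * t
  4kh+6k≤ht = ℕₚ.+-cancelʳ-≤ h (4 * k * h + 6 * k) (h * t) (begin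
    4 * k * h + 6 * k + h   ≤⟨ ℕₚ.+-monoˡ-≤ h (ℕₚ.+-monoʳ-≤ (4 * k * h) (ℕₚ.*-mono-≤ (ℕₚ.n≤1+n 6) k≤h)) ⟩
    4 * k * h + 7 * h + h   ≡⟨ regroup k h ⟩
    (4 * k + 8) * h         ≤⟨ ℕₚ.*-monoˡ-≤ h 4k+8≤h ⟩
    h * h                   ≤⟨ ℕₚ.*-monoʳ-≤ h h≤1+t ⟩
    h * (1 + t)             ≡⟨ ℕₚ.*-comm h (1 + t) ⟩
    h + t * h               ≡⟨ cong₂ _+_ refl (ℕₚ.*-comm t h) ⟩
    h + h * t               ≡⟨ ℕₚ.+-comm h (h * t) ⟩
    h * t + h               ∎)
    where
    regroup : ∀ k h → 4 * k * h + 7 * h + h ≡ (4 * k + 8) * h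
    regroup = solveℕ

-- Here h ≈ m/2 and t ≈ (√3/2) m, so 6ht ≈ (3√3/2) m²; the slack k/(k + 1) pays for replacing
-- 2h + 3 by 2h and t + 2 by t, which is where h ≥ 4k + 8, i.e. m ≥ 8k + 19, comes from.
length-bound : ∀ k h t m L → 8 * k + 19 ≤ m → 2 * h + 2 ≤ m → m ≤ 2 * h + 3 →
  m * m < (2 + t) * (2 + t) + h * h → 6 * h * t ≤ L → 27 * k ^ 2 * m ^ 4 ≤ 4 * (k + 1) ^ 2 * L ^ 2
length-bound k h t m L 8k+19≤m 2h+2≤m m≤2h+3 m²<T²+h² 6ht≤L = begin
  27 * k ^ 2 * m ^ 4                                    ≡⟨ split k m ⟩
  9 * (k * k) * (m * m) * (3 * (m * m))                ≤⟨ ℕₚ.*-monoʳ-≤ (9 * (k * k) * (m * m)) (3m²≤4[2+t]² {h} 2h≤m m²<T²+h²) ⟩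
  9 * (k * k) * (m * m) * (4 * T²)                     ≤⟨ ℕₚ.*-monoˡ-≤ (4 * T²) (ℕₚ.*-monoʳ-≤ (9 * (k * k)) (*-self-mono-≤ m≤2h+3)) ⟩
  9 * (k * k) * ((2 * h + 3) * (2 * h + 3)) * (4 * T²) ≡⟨ square₁ k h t ⟩
  36 * (K * K)                                          ≤⟨ ℕₚ.*-monoʳ-≤ 36 (*-self-mono-≤ (k[2h+3][2+t]≤[k+1]2ht k h t 4k+8≤h (h≤1+t {h} 2h≤m m²<T²+h²))) ⟩
  36 * (K′ * K′)                                        ≡⟨ square₂ k h t ⟩
  4 * ((k + 1) * (k + 1)) * (6 * h * t * (6 * h * t))  ≤⟨ ℕₚ.*-monoʳ-≤ (4 * ((k + 1) * (k + 1))) (*-self-mono-≤ 6ht≤L) ⟩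
  4 * ((k + 1) * (k + 1)) * (L * L)                    ≡⟨ powers k L ⟩
  4 * (k + 1) ^ 2 * L ^ 2                               ∎
  where
  open ℕₚ.≤-Reasoning
  T² = (2 + t) * (2 + t)
  K = k * (2 * h + 3) * (2 + t)
  K′ = (k + 1) * (2 * h * t)
  2h≤m : 2 * h ≤ m
  2h≤m = ℕₚ.≤-trans (ℕₚ.m≤m+n (2 * h) 2) 2h+2≤m
  4k+8≤h : 4 * k + 8 ≤ h
  4k+8≤h = ℕₚ.*-cancelˡ-≤ 2 (ℕₚ.+-cancelʳ-≤ 3 (2 * (4 * k + 8)) (2 * h)
    (subst (_≤ 2 * h + 3) (eight k) (ℕₚ.≤-trans 8k+19≤m m≤2h+3)))
    where eight : ∀ k → 8 * k + 19 ≡ 2 * (4 * k + 8) + 3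
          eight = solveℕ
  split : ∀ k m → 27 * (k * (k * 1)) * (m * (m * (m * (m * 1)))) ≡ 9 * (k * k) * (m * m) * (3 * (m * m))
  split = solveℕ
  square₁ : ∀ k h t → 9 * (k * k) * ((2 * h + 3) * (2 * h + 3)) * (4 * ((2 + t) * (2 + t)))
                      ≡ 36 * (k * (2 * h + 3) * (2 + t) * (k * (2 * h + 3) * (2 + t)))
  square₁ = solveℕ
  square₂ : ∀ k h t → 36 * ((k + 1) * (2 * h * t) * ((k + 1) * (2 * h * t)))
                      ≡ 4 * ((k + 1) * (k + 1)) * (6 * h * t * (6 * h * t))
  square₂ = solveℕ
  powers : ∀ k L → 4 * ((k + 1) * (k + 1)) * (L * L) ≡ 4 * ((k + 1) * ((k + 1) * 1)) * (L * (L * 1))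
  powers = solveℕ

integer-sqrt : ∀ N → Σ ℕ λ s → s * s ≤ N × N < suc s * suc s
integer-sqrt zero = 0 , z≤n , s≤s z≤n
integer-sqrt (suc N) with integer-sqrt N
... | s , s²≤N , N<[1+s]² with suc s * suc s ≤? suc N
...   | yes [1+s]²≤1+N = suc s , [1+s]²≤1+N , ℕₚ.≤-<-trans N<[1+s]² (ℕₚ.*-mono-< (ℕₚ.n<1+n (suc s)) (ℕₚ.n<1+n (suc s)))
...   | no [1+s]²≰1+N = s , ℕₚ.m≤n⇒m≤1+n s²≤N , ℕₚ.≰⇒> [1+s]²≰1+N

halve : ∀ n → Σ ℕ λ h → 2 * h ≤ n × n ≤ 2 * h + 1
halve zero = 0 , z≤n , z≤n
halve (suc zero) = 0 , z≤n , s≤s z≤n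
halve (suc (suc n)) with halve n
... | h , 2h≤n , n≤2h+1 = suc h , subst (_≤ 2 + n) (sym (double h)) (s≤s (s≤s 2h≤n)) ,
                          subst (2 + n ≤_) (sym (double+1 h)) (s≤s (s≤s n≤2h+1))
  where
  double : ∀ h → 2 * suc h ≡ 2 + 2 * h
  double = solveℕ
  double+1 : ∀ h → 2 * suc h + 1 ≡ 2 + (2 * h + 1)
  double+1 = solveℕ

InBall-∣∣ : ∀ {m} u₁ u₂ → ∣ u₁ ∣ * ∣ u₁ ∣ + ∣ u₂ ∣ * ∣ u₂ ∣ ≤ m * m → InBall m (u₁ , u₂)
InBall-∣∣ {m} u₁ u₂ bound = subst₂ _≤ᶻ_
  (trans (ℤₚ.pos-+ (∣ u₁ ∣ * ∣ u₁ ∣) _) (sym (cong₂ _+ᶻ_ (i*i≡∣i∣*∣i∣ u₁) (i*i≡∣i∣*∣i∣ u₂))))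
  (ℤₚ.pos-* m m) (+≤+ bound)

relation-of-height-width : ∀ k m h t → 8 * k + 19 ≤ m → 2 * h + 2 ≤ m → m ≤ 2 * h + 3 →
  (1 + t) * (1 + t) + h * h ≤ m * m → m * m < (2 + t) * (2 + t) + h * h →
  Σ ℕ λ L → MinimalRelationIn m L × 27 * k ^ 2 * m ^ 4 ≤ 4 * (k + 1) ^ 2 * L ^ 2
relation-of-height-width k m zero t 8k+19≤m _ m≤3 _ _ =
  ⊥-elim (ℕₚ.<⇒≱ (ℕₚ.≤-trans (s≤s (s≤s (s≤s (s≤s z≤n)))) (ℕₚ.m≤n+m 19 (8 * k))) (ℕₚ.≤-trans 8k+19≤m m≤3))
relation-of-height-width k m h@(suc _) t 8k+19≤m 2h+2≤m m≤2h+3 [1+t]²+h²≤m² m²<[2+t]²+h² =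
  suc X + Y + X ,
  minimalRelationIn A≢B A≢C B≢C A∈B B∈B C∈B (s≤s z≤n) 1≤Y 1≤X refl (minimal-ABC (s≤s z≤n)) ,
  length-bound k h t m (suc X + Y + X) 8k+19≤m 2h+2≤m m≤2h+3 m²<[2+t]²+h² 6ht≤L
  where
  open Construction h t
  1≤X : 1 ≤ X
  1≤X = ℕₚ.≤-trans (s≤s z≤n) (ℕₚ.m≤n+m h (2 * h * t + t))
  1≤Y : 1 ≤ Y
  1≤Y = ℕₚ.≤-trans (s≤s z≤n) (ℕₚ.m≤n+m h (2 * h * t))
  6ht≤L : 6 * h * t ≤ suc X + Y + X
  6ht≤L = subst (6 * h * t ≤_) (total h t) (ℕₚ.m≤m+n (6 * h * t) (2 * t + 3 * h + 1))
    where total : ∀ h t → 6 * h * t + (2 * t + 3 * h + 1) ≡ suc (2 * h * t + t + h) + (2 * h * t + h) + (2 * h * t + t + h)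
          total = solveℕ
  A∈B : InBall m A
  A∈B = InBall-∣∣ {m} (+ t) (+ h) (ℕₚ.≤-trans (ℕₚ.+-monoˡ-≤ (h * h) (*-self-mono-≤ (ℕₚ.n≤1+n t))) [1+t]²+h²≤m²)
  B∈B : InBall m B
  B∈B = InBall-∣∣ {m} (+ 1) -[1+ 2 * h ] (ℕₚ.≤-trans B² (*-self-mono-≤ 2h+2≤m))
    where
    square : ∀ h → 1 * 1 + suc (2 * h) * suc (2 * h) + (4 * h + 2) ≡ (2 * h + 2) * (2 * h + 2)
    square = solveℕ
    B² : 1 * 1 + suc (2 * h) * suc (2 * h) ≤ (2 * h + 2) * (2 * h + 2)
    B² = subst (1 * 1 + suc (2 * h) * suc (2 * h) ≤_) (square h) (ℕₚ.m≤m+n _ (4 * h + 2))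
  C∈B : InBall m C
  C∈B = InBall-∣∣ {m} -[1+ t ] (+ h) [1+t]²+h²≤m²

relation-of-height : ∀ k m h → 8 * k + 19 ≤ m → 2 * h + 2 ≤ m → m ≤ 2 * h + 3 → h * h < m * m →
  Σ ℕ λ L → MinimalRelationIn m L × 27 * k ^ 2 * m ^ 4 ≤ 4 * (k + 1) ^ 2 * L ^ 2
relation-of-height k m h 8k+19≤m 2h+2≤m m≤2h+3 h²<m² with integer-sqrt (m * m ∸ h * h)
... | zero , _ , m²-h²<1 = ⊥-elim (ℕₚ.<⇒≱ h²<m² (ℕₚ.m∸n≡0⇒m≤n (ℕₚ.n<1⇒n≡0 m²-h²<1)))
... | suc t , [1+t]²≤m²-h² , m²-h²<[2+t]² = relation-of-height-width k m h t 8k+19≤m 2h+2≤m m≤2h+3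
  (ℕₚ.≤-trans (ℕₚ.+-monoˡ-≤ (h * h) [1+t]²≤m²-h²) (ℕₚ.≤-reflexive m²-h²+h²≡m²))
  (subst (_< (2 + t) * (2 + t) + h * h) m²-h²+h²≡m² (ℕₚ.+-monoˡ-< (h * h) m²-h²<[2+t]²))
  where
  m²-h²+h²≡m² : m * m ∸ h * h + h * h ≡ m * m
  m²-h²+h²≡m² = ℕₚ.m∸n+n≡m (ℕₚ.<⇒≤ h²<m²)

2≤8k+19 : ∀ k → 2 ≤ 8 * k + 19
2≤8k+19 k = ℕₚ.≤-trans (s≤s (s≤s z≤n)) (ℕₚ.m≤n+m 19 (8 * k))

lower-bound : ∀ k m → 8 * k + 19 ≤ m → Σ ℕ λ L → MinimalRelationIn m L × 27 * k ^ 2 * m ^ 4 ≤ 4 * (k + 1) ^ 2 * L ^ 2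
lower-bound k m 8k+19≤m with halve (m ∸ 2)
... | h , 2h≤m-2 , m-2≤2h+1 = relation-of-height k m h 8k+19≤m 2h+2≤m m≤2h+3 (ℕₚ.*-mono-< h<m h<m)
  where
  2≤m : 2 ≤ m
  2≤m = ℕₚ.≤-trans (2≤8k+19 k) 8k+19≤m
  2h+2≤m : 2 * h + 2 ≤ m
  2h+2≤m = subst (2 * h + 2 ≤_) (ℕₚ.m∸n+n≡m 2≤m) (ℕₚ.+-monoˡ-≤ 2 2h≤m-2)
  m≤2h+3 : m ≤ 2 * h + 3
  m≤2h+3 = subst₂ _≤_ (ℕₚ.m∸n+n≡m 2≤m) (ℕₚ.+-assoc (2 * h) 1 2) (ℕₚ.+-monoˡ-≤ 2 m-2≤2h+1)
  h<m : h < m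
  h<m = ℕₚ.<-≤-trans (ℕₚ.≤-<-trans (ℕₚ.m≤m+n h (h + 0)) (ℕₚ.m<m+n (2 * h) (s≤s z≤n))) 2h+2≤m

upper-bound : ∀ {m L} → 2 ≤ m → Achievable3 m L → 4 * (L * L) ≤ 27 * (m * m * (m * m))
upper-bound {m} 2≤m achievable with Equivalence.to (achievable⇔minimalRelationIn {m}) achievable
... | minimalRelationIn _ _ _ a∈B b∈B c∈B 1≤x 1≤y 1≤z refl R = minimal-relation-bound {m} 2≤m 1≤x 1≤y 1≤z a∈B b∈B c∈B R

weaken-upper : ∀ k m L → 4 * (L * L) ≤ 27 * (m * m * (m * m)) → 4 * (k + 1) ^ 2 * L ^ 2 ≤ 27 * (k + 2) ^ 2 * m ^ 4
weaken-upper k m L bound = subst₂ _≤_ (regroup₁ k L) (regroup₂ k m) (ℕₚ.*-mono-≤ (*-self-mono-≤ (ℕₚ.n≤1+n (k + 1))) bound)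
  where
  regroup₁ : ∀ k L → (k + 1) * (k + 1) * (4 * (L * L)) ≡ 4 * ((k + 1) * ((k + 1) * 1)) * (L * (L * 1))
  regroup₁ = solveℕ
  regroup₂ : ∀ k m → (1 + (k + 1)) * (1 + (k + 1)) * (27 * (m * m * (m * m))) ≡ 27 * ((k + 2) * ((k + 2) * 1)) * (m * (m * (m * (m * 1))))
  regroup₂ = solveℕ

theorem2 : ∀ (k : ℕ) → Σ ℕ λ M → ∀ (m : ℕ) → m ≥ M →
               ((∀ (L : ℕ) → Achievable3 m L →
                   4 * (k + 1) ^ 2 * L ^ 2 ≤ 27 * (k + 2) ^ 2 * m ^ 4)
               × (Σ ℕ λ L → Achievable3 m L ×
                   27 * k ^ 2 * m ^ 4 ≤ 4 * (k + 1) ^ 2 * L ^ 2))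
theorem2 k = 8 * k + 19 , λ m 8k+19≤m →
  (λ L → weaken-upper k m L ∘ upper-bound (ℕₚ.≤-trans (2≤8k+19 k) 8k+19≤m)) ,
  map₂ (map₁ (Equivalence.from achievable⇔minimalRelationIn)) (lower-bound k m 8k+19≤m)
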